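{- Let $m \geq 2$ and $\epsilon \in \{ -1,1\}$. (i) For every integer $n \geq 2$, \[w_{2n+1,2^{m}}^{+}=w_{2n+1,2^{m}}^{ - }=\frac{2^{2mn-2n-2m-1}(2^{2n+3}-8)}{3}.\] (ii) For every integer $n \geq 3$, setting for each integer $k\ge 2$ \[D_{k}:=\frac{2^{mk-k-3m}\left(2^{k+1}+8 \times (-1)^{k+1}\right)}{3},\] one has \[\left|\Omega_{2n}^{\epsilon}(m)\right| \geq D_{2n}+2^{m-1}D_{2n-1}+m2^{m-1}D_{2n-4}\] and \[\left|\Omega_{2n}^{\epsilon}(m)\right| \leq D_{2n}+2^{m-1}D_{2n-1}+2^{2m-2}D_{2n-1}.\]
   Context: For a commutative unitary ring $A$ and $a_1,\ldots,a_n\in A$, set \[M_{n}(a_1,\ldots,a_n):=\begin{pmatrix} a_{n} & -1 \\ 1 & 0\end{pmatrix}\begin{pmatrix} a_{n-1} & -1 \\ 1 & 0\end{pmatrix}\cdots\begin{pmatrix} a_{1} & -1 \\ 1 & 0\end{pmatrix}.\] For $m\ge 2$, $n\ge 2$ and $\epsilon\in\{ -1,1\}$, let $\Omega_{n}^{\epsilon}(m):=\{(a_{1},\ldots,a_{n}) \in (\mathbb{Z}/2^{m}\mathbb{Z})^{n}:~M_{n}(a_{1},\ldots,a_{n})=\epsilon Id\}$, $w_{n,2^{m}}^{+}:=|\Omega_{n}^{1}(m)|$ and $w_{n,2^{m}}^{ - }:=|\Omega_{n}^{ -1}(m)|$. -}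

module Defs where

open import Data.Nat as ℕ using (ℕ; zero; suc; NonZero)
open import Data.Nat.Properties using (m^n≢0)
open import Data.Nat.DivMod using (_mod_)
open import Data.Fin as Fin using (Fin; toℕ)
open import Data.Fin.Properties using () renaming (_≟_ to _≟ᶠ_)
open import Data.Vec as Vec using (Vec; []; _∷_)
open import Data.List as List using (List; [_]; concatMap; length; filter; allFin)
open import Data.Integer as ℤ using (ℤ; +_; -[1+_])
open import Data.Rational as ℚ using (ℚ; _/_)
open import Data.Product using (_×_; _,_)
open import Data.Product.Properties using (≡-dec)
open import Relation.Binary.PropositionalEquality using (_≡_)
open import Relation.Nullary using (Dec)

module ZMod (N : ℕ) .{{_ : NonZero N}} where

  Zn : Set
  Zn = Fin N

  _⊕_ : Zn → Zn → Zn
  a ⊕ b = (toℕ a ℕ.+ toℕ b) mod N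

  _⊗_ : Zn → Zn → Zn
  a ⊗ b = (toℕ a ℕ.* toℕ b) mod N

  ⊖_ : Zn → Zn
  ⊖ a = (N ℕ.∸ toℕ a) mod N

  𝟘 𝟙 : Zn
  𝟘 = 0 mod N
  𝟙 = 1 mod N

  -- 2×2 matrices ((a , b) , (c , d)) = [[a , b] , [c , d]]
  Mat : Set
  Mat = (Zn × Zn) × (Zn × Zn)

  _·_ : Mat → Mat → Mat
  ((a , b) , (c , d)) · ((a' , b') , (c' , d')) =
    ( ((a ⊗ a') ⊕ (b ⊗ c')) , ((a ⊗ b') ⊕ (b ⊗ d')) ) ,
    ( ((c ⊗ a') ⊕ (d ⊗ c')) , ((c ⊗ b') ⊕ (d ⊗ d')) )

  _≟M_ : (X Y : Mat) → Dec (X ≡ Y)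
  _≟M_ = ≡-dec (≡-dec _≟ᶠ_ _≟ᶠ_) (≡-dec _≟ᶠ_ _≟ᶠ_)

  T : Zn → Mat
  T a = (a , ⊖ 𝟙) , (𝟙 , 𝟘)

  Id : Mat
  Id = (𝟙 , 𝟘) , (𝟘 , 𝟙)

  scal : Zn → Mat → Mat
  scal s ((a , b) , (c , d)) = ((s ⊗ a) , (s ⊗ b)) , ((s ⊗ c) , (s ⊗ d))

  -- M_n(a₁,…,aₙ) = T(aₙ) T(aₙ₋₁) ⋯ T(a₁); the vector is (a₁ ∷ a₂ ∷ … ∷ aₙ ∷ [])
  M : ∀ {n} → Vec Zn n → Mat
  M []       = Id
  M (a ∷ as) = M as · T a

  allVecs : (n : ℕ) → List (Vec Zn n)
  allVecs zero    = [ [] ]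
  allVecs (suc n) = concatMap (λ v → List.map (_∷ v) (allFin N)) (allVecs n)

  count : (n : ℕ) → Mat → ℕ
  count n X = length (filter (λ v → M v ≟M X) (allVecs n))

data PM1 : Set where
  plus minus : PM1

pm : PM1 → ℤ
pm plus  = + 1
pm minus = -[1+ 0 ]

module _ (m : ℕ) where
  open ZMod (2 ℕ.^ m) {{m^n≢0 2 m}}

  εId : PM1 → Mat
  εId plus  = Id
  εId minus = scal (⊖ 𝟙) Id

Ω-card : (m n : ℕ) → PM1 → ℕ
Ω-card m n ε = ZMod.count (2 ℕ.^ m) {{m^n≢0 2 m}} n (εId m ε)

w⁺ w⁻ : (n m : ℕ) → ℕ
w⁺ n m = Ω-card m n plus
w⁻ n m = Ω-card m n minus

pow2 : ℤ → ℚ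
pow2 (+ e)      = (+ (2 ℕ.^ e)) / 1
pow2 -[1+ e ]   = _/_ (+ 1) (2 ℕ.^ suc e) {{m^n≢0 2 (suc e)}}

ℕ→ℚ : ℕ → ℚ
ℕ→ℚ k = (+ k) / 1

D : (m k : ℕ) → ℚ
D m k = pow2 ((+ m) ℤ.* (+ k) ℤ.- (+ k) ℤ.- (+ (3 ℕ.* m)))
        ℚ.* ((+ (2 ℕ.^ (k ℕ.+ 1)) ℤ.+ (+ 8) ℤ.* (-[1+ 0 ] ℤ.^ (k ℕ.+ 1))) / 3)

oddFormula : (m n : ℕ) → ℚ
oddFormula m n =
  pow2 ((+ 2) ℤ.* (+ m) ℤ.* (+ n) ℤ.- (+ 2) ℤ.* (+ n) ℤ.- (+ 2) ℤ.* (+ m) ℤ.- (+ 1))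
  ℚ.* ((+ (2 ℕ.^ (2 ℕ.* n ℕ.+ 3)) ℤ.- (+ 8)) / 3)

-- For ε = ±1, M (a ∷ b ∷ u) = ε·Id forces the top-left entry of M u to
-- be −ε and then determines b and a (the remaining entry follows from det = 1), so |Ω_{n+2}^ε(m)| is the
-- number of words u of length n whose product has top-left entry −ε. Modulo 2 the top row of M u never
-- vanishes and odd residues are units of ℤ/2^m, so adding a letter acts on an odd top-left entry by an
-- affine bijection. This gives U_{n+1} + 2^{m−1} U_n = 2^{m(n+1)} for the number U_n of words with odd
-- top-left entry, hence 3 U_n = 2^{(m−1)n} (2^{n+1} + (−1)^n). Adding two letters expresses the fibres of
-- the top-left entry at length n + 2 through those at length n and the number of pairs (t, b) with t even
-- and tb = d. For odd n the fibres over odd residues therefore all have the same size, which gives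
-- 2^{m−1} |Ω_{2n+1}^ε(m)| = U_{2n−1}, the closed formula. For even lengths the same recursion is only
-- estimated from both sides, which gives the two bounds with D_k = U_{k−3}.

module Submission where

open import Defs
open import Data.Nat using (ℕ; _≤_; _*_; _+_; _∸_; _^_)
open import Data.Product using (_×_)
open import Relation.Binary.PropositionalEquality using (_≡_)
open import Data.Rational using () renaming (_≤_ to _≤ℚ_; _+_ to _+ℚ_; _*_ to _*ℚ_)

open import Level using (0ℓ)
open import Function using (_∘_; _⇔_; mk⇔; Equivalence)
open import Data.Empty using (⊥-elim)
open import Data.Product using (_,_; proj₁; proj₂; ∃-syntax)
open import Data.Sum using (_⊎_; inj₁; inj₂)
open import Data.Maybe using (Maybe; just; nothing)
open import Relation.Nullary using (Dec; yes; no; ¬_; contradiction)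
open import Relation.Unary using (Pred; Decidable)
open import Relation.Binary.PropositionalEquality
  using (_≢_; refl; sym; trans; cong; cong₂; subst; subst₂; isEquivalence; module ≡-Reasoning)

open import Data.Nat using (zero; suc; z≤n; s≤s; NonZero; >-nonZero⁻¹; _%_; _<_)
import Data.Nat.Properties as ℕ
open import Data.Nat.DivMod
  using (_mod_; m≡m%n+[m/n]*n; m<n⇒m%n≡m; m%n<n; m%n%n≡m%n; n%n≡0; %-distribˡ-+; %-distribˡ-*; %-remove-+ʳ; m∣n⇒o%n%m≡o%m)
  renaming (_/_ to _/ℕ_)
open import Data.Nat.Divisibility using (divides; m∣m*n)
open import Data.Nat.Tactic.RingSolver using () renaming (solve-∀ to ℕ-solve-∀)
open import Data.Fin using (Fin; zero; suc; toℕ)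
open import Data.Fin.Properties using (suc-injective; 0≢1+n; toℕ-fromℕ<; toℕ-injective; toℕ<n) renaming (_≟_ to _≟ᶠ_)
open import Data.Fin.Permutation using (permutation)
open import Data.Vec using (Vec; []; _∷_)
open import Data.List as List using (List; []; _∷_; filter; length; allFin)
import Data.List.Properties as List
open import Data.Nat.ListAction using () renaming (sum to sumˡ)
open import Data.Nat.ListAction.Properties using () renaming (sum-++ to sumˡ-++)
open import Data.Integer as ℤ using (ℤ; -[1+_]; +[1+_])
import Data.Integer.Properties as ℤ
open import Data.Integer.Tactic.RingSolver using (solve-∀)
open import Data.Rational as ℚ using (ℚ; _/_; fromℚᵘ)
import Data.Rational.Properties as ℚ
import Data.Rational.Unnormalised as ℚᵘ
import Data.Rational.Unnormalised.Properties as ℚᵘ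

open import Algebra.Bundles using (CommutativeRing)
open import Algebra.Structures using (IsCommutativeRing)
open import Algebra.Consequences.Propositional using (comm∧idˡ⇒id; comm∧invˡ⇒inv; comm∧distrʳ⇒distrˡ)
open import Algebra.Properties.Semiring.Sum ℕ.+-*-semiring
  using (sum; sum-syntax; sum-cong-≗; sum-replicate-zero; ∑-distrib-+; ∑-comm; ∑-permute)
open import Algebra.Solver.Ring.AlmostCommutativeRing using (_-Raw-AlmostCommutative⟶_; fromCommutativeRing)
import Algebra.Solver.Ring

-- Finite sums

indicator : ∀ {p} {P : Set p} → Dec P → ℕ
indicator (yes _) = 1
indicator (no _)  = 0

module _ {p} {P : Set p} where

  indicator-yes : (d : Dec P) → P → indicator d ≡ 1
  indicator-yes (yes _) _  = refl
  indicator-yes (no ¬p) p′ = ⊥-elim (¬p p′)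

  indicator-no : (d : Dec P) → ¬ P → indicator d ≡ 0
  indicator-no (yes p′) ¬p = ⊥-elim (¬p p′)
  indicator-no (no _)   _  = refl

  indicator≤1 : (d : Dec P) → indicator d ≤ 1
  indicator≤1 (yes _) = s≤s z≤n
  indicator≤1 (no _)  = z≤n

  indicator-cong : ∀ {q} {Q : Set q} (d : Dec P) (e : Dec Q) → P ⇔ Q → indicator d ≡ indicator e
  indicator-cong (yes _) (yes _) _   = refl
  indicator-cong (yes p′) (no ¬q) P⇔Q = ⊥-elim (¬q (Equivalence.to P⇔Q p′))
  indicator-cong (no ¬p) (yes q) P⇔Q = ⊥-elim (¬p (Equivalence.from P⇔Q q))
  indicator-cong (no _)  (no _)  _   = refl

∑-const : ∀ n c → ∑[ i < n ] c ≡ n * c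
∑-const zero    c = refl
∑-const (suc n) c = cong (c +_) (∑-const n c)

∑-mono-≤ : ∀ {n} {f g : Fin n → ℕ} → (∀ i → f i ≤ g i) → sum f ≤ sum g
∑-mono-≤ {zero}  f≤g = z≤n
∑-mono-≤ {suc n} f≤g = ℕ.+-mono-≤ (f≤g zero) (∑-mono-≤ (f≤g ∘ suc))

*-distribˡ-∑ : ∀ {n} c (f : Fin n → ℕ) → ∑[ i < n ] (c * f i) ≡ c * sum f
*-distribˡ-∑ {zero}  c f = sym (ℕ.*-zeroʳ c)
*-distribˡ-∑ {suc n} c f =
  trans (cong (c * f zero +_) (*-distribˡ-∑ c (f ∘ suc))) (sym (ℕ.*-distribˡ-+ c (f zero) _))

*-distribʳ-∑ : ∀ {n} c (f : Fin n → ℕ) → ∑[ i < n ] (f i * c) ≡ sum f * c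
*-distribʳ-∑ c f =
  trans (sum-cong-≗ (λ i → ℕ.*-comm (f i) c)) (trans (*-distribˡ-∑ c f) (ℕ.*-comm c _))

∑-indicator-unique : ∀ {n p} {P : Pred (Fin n) p} (P? : Decidable P) (j : Fin n) →
                     (∀ i → P i ⇔ i ≡ j) → ∑[ i < n ] indicator (P? i) ≡ 1
∑-indicator-unique {suc n} P? zero P⇔ = begin
  indicator (P? zero) + ∑[ i < n ] indicator (P? (suc i))
    ≡⟨ cong₂ _+_ (indicator-yes (P? zero) (Equivalence.from (P⇔ zero) refl))
                 (sum-cong-≗ λ i → indicator-no (P? (suc i)) (0≢1+n ∘ sym ∘ Equivalence.to (P⇔ (suc i)))) ⟩
  1 + ∑[ i < n ] 0
    ≡⟨ cong suc (sum-replicate-zero n) ⟩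
  1 ∎
  where open ≡-Reasoning
∑-indicator-unique {suc n} P? (suc j) P⇔ = begin
  indicator (P? zero) + ∑[ i < n ] indicator (P? (suc i))
    ≡⟨ cong (_+ ∑[ i < n ] indicator (P? (suc i))) (indicator-no (P? zero) (0≢1+n ∘ Equivalence.to (P⇔ zero))) ⟩
  ∑[ i < n ] indicator (P? (suc i))
    ≡⟨ ∑-indicator-unique (P? ∘ suc) j (λ i → mk⇔ (suc-injective ∘ Equivalence.to (P⇔ (suc i)))
                                                    (Equivalence.from (P⇔ (suc i)) ∘ cong suc)) ⟩
  1 ∎
  where open ≡-Reasoning

∑-indicator-⊥ : ∀ {n p} {P : Pred (Fin n) p} (P? : Decidable P) → (∀ i → ¬ P i) → ∑[ i < n ] indicator (P? i) ≡ 0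
∑-indicator-⊥ {n} P? ¬P = trans (sum-cong-≗ (λ i → indicator-no (P? i) (¬P i))) (sum-replicate-zero n)

∑∑-indicator-unique : ∀ {m n p} {P : Fin m → Fin n → Set p} (P? : ∀ i j → Dec (P i j)) (i₀ : Fin m) (j₀ : Fin n) →
                      (∀ i j → P i j ⇔ (i ≡ i₀ × j ≡ j₀)) → ∑[ i < m ] ∑[ j < n ] indicator (P? i j) ≡ 1
∑∑-indicator-unique {m} {n} P? i₀ j₀ P⇔ =
  trans (sum-cong-≗ row-sum) (∑-indicator-unique (_≟ᶠ i₀) i₀ (λ _ → mk⇔ (λ i≡ → i≡) (λ i≡ → i≡)))
  where
  row-sum : ∀ i → ∑[ j < n ] indicator (P? i j) ≡ indicator (i ≟ᶠ i₀)
  row-sum i with i ≟ᶠ i₀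
  ... | yes refl = ∑-indicator-unique (P? i₀) j₀ (λ j → mk⇔ (proj₂ ∘ Equivalence.to (P⇔ i₀ j))
                                                          (λ j≡ → Equivalence.from (P⇔ i₀ j) (refl , j≡)))
  ... | no i≢i₀  = ∑-indicator-⊥ (P? i) (λ j → i≢i₀ ∘ proj₁ ∘ Equivalence.to (P⇔ i j))

∑-reindex : ∀ {n} (σ τ : Fin n → Fin n) → (∀ i → σ (τ i) ≡ i) → (∀ i → τ (σ i) ≡ i) →
            (f : Fin n → ℕ) → ∑[ i < n ] f (σ i) ≡ sum f
∑-reindex σ τ στ τσ f = sym (∑-permute f (permutation σ τ στ τσ))

∑-δ : ∀ {n} (j : Fin n) (f : Fin n → ℕ) → ∑[ i < n ] (indicator (i ≟ᶠ j) * f i) ≡ f j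
∑-δ {suc n} zero f = begin
  1 * f zero + ∑[ i < n ] (indicator (suc i ≟ᶠ zero) * f (suc i)) ≡⟨ cong₂ _+_ (ℕ.*-identityˡ (f zero)) (sum-replicate-zero n) ⟩
  f zero + 0                                                      ≡⟨ ℕ.+-identityʳ (f zero) ⟩
  f zero ∎
  where open ≡-Reasoning
∑-δ {suc n} (suc j) f = begin
  0 * f zero + ∑[ i < n ] (indicator (suc i ≟ᶠ suc j) * f (suc i))
    ≡⟨ sum-cong-≗ (λ i → cong (_* f (suc i)) (indicator-cong (suc i ≟ᶠ suc j) (i ≟ᶠ j) (mk⇔ suc-injective (cong suc)))) ⟩
  ∑[ i < n ] (indicator (i ≟ᶠ j) * f (suc i))
    ≡⟨ ∑-δ j (f ∘ suc) ⟩
  f (suc j) ∎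
  where open ≡-Reasoning

module _ {N : ℕ} where

  ∑ᵛ : ∀ n → (Vec (Fin N) n → ℕ) → ℕ
  ∑ᵛ zero    g = g []
  ∑ᵛ (suc n) g = ∑ᵛ n (λ v → ∑[ a < N ] g (a ∷ v))

  ∑ᵛ-cong : ∀ n {f g : Vec (Fin N) n → ℕ} → (∀ v → f v ≡ g v) → ∑ᵛ n f ≡ ∑ᵛ n g
  ∑ᵛ-cong zero    f≗g = f≗g []
  ∑ᵛ-cong (suc n) f≗g = ∑ᵛ-cong n (λ v → sum-cong-≗ (λ a → f≗g (a ∷ v)))

  ∑ᵛ-distrib-+ : ∀ n (f g : Vec (Fin N) n → ℕ) → ∑ᵛ n (λ v → f v + g v) ≡ ∑ᵛ n f + ∑ᵛ n g
  ∑ᵛ-distrib-+ zero    f g = refl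
  ∑ᵛ-distrib-+ (suc n) f g = trans (∑ᵛ-cong n (λ v → ∑-distrib-+ (λ a → f (a ∷ v)) (λ a → g (a ∷ v))))
                                   (∑ᵛ-distrib-+ n _ _)

  *-distribˡ-∑ᵛ : ∀ n c (f : Vec (Fin N) n → ℕ) → ∑ᵛ n (λ v → c * f v) ≡ c * ∑ᵛ n f
  *-distribˡ-∑ᵛ zero    c f = refl
  *-distribˡ-∑ᵛ (suc n) c f = trans (∑ᵛ-cong n (λ v → *-distribˡ-∑ c (λ a → f (a ∷ v)))) (*-distribˡ-∑ᵛ n c _)

  ∑ᵛ-const : ∀ n c → ∑ᵛ n (λ _ → c) ≡ N ^ n * c
  ∑ᵛ-const zero    c = sym (ℕ.+-identityʳ c)
  ∑ᵛ-const (suc n) c = begin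
    ∑ᵛ n (λ _ → ∑[ a < N ] c) ≡⟨ ∑ᵛ-cong n (λ _ → ∑-const N c) ⟩
    ∑ᵛ n (λ _ → N * c)        ≡⟨ ∑ᵛ-const n (N * c) ⟩
    N ^ n * (N * c)           ≡⟨ sym (ℕ.*-assoc (N ^ n) N c) ⟩
    N ^ n * N * c             ≡⟨ cong (_* c) (ℕ.*-comm (N ^ n) N) ⟩
    N * N ^ n * c             ∎
    where open ≡-Reasoning

  ∑ᵛ-mono-≤ : ∀ n {f g : Vec (Fin N) n → ℕ} → (∀ v → f v ≤ g v) → ∑ᵛ n f ≤ ∑ᵛ n g
  ∑ᵛ-mono-≤ zero    f≤g = f≤g []
  ∑ᵛ-mono-≤ (suc n) f≤g = ∑ᵛ-mono-≤ n (λ v → ∑-mono-≤ (λ a → f≤g (a ∷ v)))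

  ∑ᵛ-comm-∑ : ∀ n {m} (f : Vec (Fin N) n → Fin m → ℕ) →
              ∑ᵛ n (λ v → ∑[ j < m ] f v j) ≡ ∑[ j < m ] ∑ᵛ n (λ v → f v j)
  ∑ᵛ-comm-∑ zero    f = refl
  ∑ᵛ-comm-∑ (suc n) f = trans (∑ᵛ-cong n (λ v → ∑-comm (λ a → f (a ∷ v)))) (∑ᵛ-comm-∑ n (λ v j → ∑[ a < N ] f (a ∷ v) j))

length-filter≡sum-indicator : ∀ {a p} {A : Set a} {P : Pred A p} (P? : Decidable P) xs →
                              length (filter P? xs) ≡ sumˡ (List.map (indicator ∘ P?) xs)
length-filter≡sum-indicator P? []       = refl
length-filter≡sum-indicator P? (x ∷ xs) with P? x
... | yes _ = cong suc (length-filter≡sum-indicator P? xs)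
... | no _  = length-filter≡sum-indicator P? xs

sum-concatMap : ∀ {a b} {A : Set a} {B : Set b} (f : A → List B) (g : B → ℕ) xs →
                sumˡ (List.map g (List.concatMap f xs)) ≡ sumˡ (List.map (sumˡ ∘ List.map g ∘ f) xs)
sum-concatMap f g []       = refl
sum-concatMap f g (x ∷ xs) = begin
  sumˡ (List.map g (f x List.++ List.concatMap f xs))
    ≡⟨ cong sumˡ (List.map-++ g (f x) _) ⟩
  sumˡ (List.map g (f x) List.++ List.map g (List.concatMap f xs))
    ≡⟨ sumˡ-++ (List.map g (f x)) _ ⟩
  sumˡ (List.map g (f x)) + sumˡ (List.map g (List.concatMap f xs))
    ≡⟨ cong (sumˡ (List.map g (f x)) +_) (sum-concatMap f g xs) ⟩
  sumˡ (List.map (sumˡ ∘ List.map g ∘ f) (x ∷ xs)) ∎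
  where open ≡-Reasoning

sum-map-tabulate : ∀ {a} {A : Set a} {n} (f : Fin n → A) (g : A → ℕ) →
                   sumˡ (List.map g (List.tabulate f)) ≡ ∑[ i < n ] g (f i)
sum-map-tabulate {n = zero}  f g = refl
sum-map-tabulate {n = suc n} f g = cong (g (f zero) +_) (sum-map-tabulate (f ∘ suc) g)

-- Parity and powers of two

%2-cases : ∀ x → x % 2 ≡ 0 ⊎ x % 2 ≡ 1
%2-cases zero          = inj₁ refl
%2-cases (suc zero)    = inj₂ refl
%2-cases (suc (suc x)) = %2-cases x

c%2+[1+c]%2≡1 : ∀ c → c % 2 + suc c % 2 ≡ 1
c%2+[1+c]%2≡1 zero          = refl
c%2+[1+c]%2≡1 (suc zero)    = refl
c%2+[1+c]%2≡1 (suc (suc c)) = c%2+[1+c]%2≡1 c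

∑-parity-shift : ∀ n c → ∑[ i < 2 * n ] ((toℕ i % 2 + c) % 2) ≡ n
∑-parity-shift zero    c = refl
∑-parity-shift (suc n) c = subst (λ m → ∑[ i < m ] ((toℕ i % 2 + c) % 2) ≡ suc n) (sym (ℕ.*-suc 2 n))
  (trans (sym (ℕ.+-assoc (c % 2) (suc c % 2) _)) (cong₂ _+_ (c%2+[1+c]%2≡1 c) (∑-parity-shift n c)))

pos-^ : ∀ m n → ℤ.+ (m ^ n) ≡ (ℤ.+ m) ℤ.^ n
pos-^ m zero    = refl
pos-^ m (suc n) = trans (ℤ.pos-* m (m ^ n)) (cong (ℤ._*_ (ℤ.+ m)) (pos-^ m n))

^-distribʳ-* : ∀ i j n → (i ℤ.* j) ℤ.^ n ≡ i ℤ.^ n ℤ.* j ℤ.^ n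
^-distribʳ-* i j zero    = refl
^-distribʳ-* i j (suc n) = trans (cong ((i ℤ.* j) ℤ.*_) (^-distribʳ-* i j n)) (interchange i j (i ℤ.^ n) (j ℤ.^ n))
  where
  interchange : ∀ a b c d → a ℤ.* b ℤ.* (c ℤ.* d) ≡ a ℤ.* c ℤ.* (b ℤ.* d)
  interchange = solve-∀

n<2^n : ∀ n → n < 2 ^ n
n<2^n zero    = s≤s z≤n
n<2^n (suc n) = ℕ.≤-trans (ℕ.+-mono-≤ (ℕ.m^n>0 2 n) (n<2^n n)) (ℕ.≤-reflexive (cong (2 ^ n +_) (sym (ℕ.+-identityʳ (2 ^ n)))))

odd^2^k : ∀ k x → x % 2 ≡ 1 → ∃[ t ] x ^ (2 ^ k) ≡ 1 + 2 ^ suc k * t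
odd^2^k zero    x x-odd = x /ℕ 2 , (begin
  x * 1                 ≡⟨ ℕ.*-identityʳ x ⟩
  x                     ≡⟨ m≡m%n+[m/n]*n x 2 ⟩
  x % 2 + x /ℕ 2 * 2     ≡⟨ cong₂ _+_ x-odd (ℕ.*-comm (x /ℕ 2) 2) ⟩
  1 + 2 * 1 * (x /ℕ 2)   ∎)
  where open ≡-Reasoning
odd^2^k (suc k) x x-odd = let t , x^2^k≡ = odd^2^k k x x-odd in t + 2 ^ k * t * t , (begin
  x ^ (2 * 2 ^ k)                  ≡⟨ cong (x ^_) (ℕ.*-comm 2 (2 ^ k)) ⟩
  x ^ (2 ^ k * 2)                  ≡⟨ sym (ℕ.^-*-assoc x (2 ^ k) 2) ⟩
  (x ^ (2 ^ k)) ^ 2                ≡⟨ cong (_^ 2) x^2^k≡ ⟩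
  (1 + 2 * 2 ^ k * t) ^ 2          ≡⟨ square (2 ^ k) t ⟩
  1 + 2 * (2 * 2 ^ k) * (t + 2 ^ k * t * t) ∎)
  where
  open ≡-Reasoning
  square : ∀ A t → (1 + 2 * A * t) * ((1 + 2 * A * t) * 1) ≡ 1 + 2 * (2 * A) * (t + A * t * t)
  square = ℕ-solve-∀

2^-+ : ∀ a b → ℤ.+ (2 ^ a) ℤ.* ℤ.+ (2 ^ b) ≡ ℤ.+ (2 ^ (a + b))
2^-+ a b = trans (sym (ℤ.pos-* (2 ^ a) (2 ^ b))) (cong ℤ.+_ (sym (ℕ.^-distribˡ-+-* 2 a b)))

-- Rational arithmetic

fromℚᵘ-homo-+ : ∀ p q → fromℚᵘ (p ℚᵘ.+ q) ≡ fromℚᵘ p ℚ.+ fromℚᵘ q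
fromℚᵘ-homo-+ p q = ℚ.toℚᵘ-injective (ℚᵘ.≃-trans (ℚ.toℚᵘ-fromℚᵘ (p ℚᵘ.+ q))
  (ℚᵘ.≃-trans (ℚᵘ.+-cong (ℚᵘ.≃-sym (ℚ.toℚᵘ-fromℚᵘ p)) (ℚᵘ.≃-sym (ℚ.toℚᵘ-fromℚᵘ q)))
              (ℚᵘ.≃-sym (ℚ.toℚᵘ-homo-+ (fromℚᵘ p) (fromℚᵘ q)))))

fromℚᵘ-homo-* : ∀ p q → fromℚᵘ (p ℚᵘ.* q) ≡ fromℚᵘ p ℚ.* fromℚᵘ q
fromℚᵘ-homo-* p q = ℚ.toℚᵘ-injective (ℚᵘ.≃-trans (ℚ.toℚᵘ-fromℚᵘ (p ℚᵘ.* q))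
  (ℚᵘ.≃-trans (ℚᵘ.*-cong (ℚᵘ.≃-sym (ℚ.toℚᵘ-fromℚᵘ p)) (ℚᵘ.≃-sym (ℚ.toℚᵘ-fromℚᵘ q)))
              (ℚᵘ.≃-sym (ℚ.toℚᵘ-homo-* (fromℚᵘ p) (fromℚᵘ q)))))

fromℚᵘ-mono-≤ : ∀ {p q} → p ℚᵘ.≤ q → fromℚᵘ p ℚ.≤ fromℚᵘ q
fromℚᵘ-mono-≤ {p} {q} p≤q = ℚ.toℚᵘ-cancel-≤
  (ℚᵘ.≤-respˡ-≃ (ℚᵘ.≃-sym (ℚ.toℚᵘ-fromℚᵘ p)) (ℚᵘ.≤-respʳ-≃ (ℚᵘ.≃-sym (ℚ.toℚᵘ-fromℚᵘ q)) p≤q))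

/-cong-≃ : ∀ i m j n .{{_ : NonZero m}} .{{_ : NonZero n}} → i ℤ.* ℤ.+ n ≡ j ℤ.* ℤ.+ m → i / m ≡ j / n
/-cong-≃ i (suc m) j (suc n) eq = ℚ.fromℚᵘ-cong {ℚᵘ.mkℚᵘ i m} {ℚᵘ.mkℚᵘ j n} (ℚᵘ.*≡* eq)

/-*-/ : ∀ i j m n .{{_ : NonZero m}} .{{_ : NonZero n}} → (i / m) ℚ.* (j / n) ≡ _/_ (i ℤ.* j) (m * n) {{ℕ.m*n≢0 m n}}
/-*-/ i j (suc m) (suc n) = sym (fromℚᵘ-homo-* (ℚᵘ.mkℚᵘ i m) (ℚᵘ.mkℚᵘ j n))

ℕ→ℚ-+ : ∀ a b → ℕ→ℚ (a + b) ≡ ℕ→ℚ a ℚ.+ ℕ→ℚ b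
ℕ→ℚ-+ a b = trans (/-cong-≃ (ℤ.+ (a + b)) 1 (ℤ.+ a ℤ.* ℤ.+ 1 ℤ.+ ℤ.+ b ℤ.* ℤ.+ 1) 1 (cong (ℤ._* ℤ.+ 1) (trans (ℤ.pos-+ a b) (sym (cong₂ ℤ._+_ (ℤ.*-identityʳ (ℤ.+ a)) (ℤ.*-identityʳ (ℤ.+ b)))))))
                  (fromℚᵘ-homo-+ (ℚᵘ.mkℚᵘ (ℤ.+ a) 0) (ℚᵘ.mkℚᵘ (ℤ.+ b) 0))

ℕ→ℚ-* : ∀ a b → ℕ→ℚ (a * b) ≡ ℕ→ℚ a ℚ.* ℕ→ℚ b
ℕ→ℚ-* a b = trans (cong (λ x → x / 1) (ℤ.pos-* a b)) (sym (/-*-/ (ℤ.+ a) (ℤ.+ b) 1 1))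

ℕ→ℚ-mono-≤ : ∀ {a b} → a ≤ b → ℕ→ℚ a ℚ.≤ ℕ→ℚ b
ℕ→ℚ-mono-≤ {a} {b} a≤b = fromℚᵘ-mono-≤ {ℚᵘ.mkℚᵘ (ℤ.+ a) 0} {ℚᵘ.mkℚᵘ (ℤ.+ b) 0} (ℚᵘ.*≤* (ℤ.*-monoʳ-≤-nonNeg (ℤ.+ 1) (ℤ.+≤+ a≤b)))

ℕ→ℚ-linear : ∀ a b x c y → ℕ→ℚ a ℚ.+ ℕ→ℚ b ℚ.* ℕ→ℚ x ℚ.+ ℕ→ℚ c ℚ.* ℕ→ℚ y ≡ ℕ→ℚ (a + b * x + c * y)
ℕ→ℚ-linear a b x c y = sym (begin
  ℕ→ℚ (a + b * x + c * y)                           ≡⟨ ℕ→ℚ-+ (a + b * x) (c * y) ⟩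
  ℕ→ℚ (a + b * x) ℚ.+ ℕ→ℚ (c * y)                   ≡⟨ cong₂ ℚ._+_ (ℕ→ℚ-+ a (b * x)) (ℕ→ℚ-* c y) ⟩
  ℕ→ℚ a ℚ.+ ℕ→ℚ (b * x) ℚ.+ ℕ→ℚ c ℚ.* ℕ→ℚ y         ≡⟨ cong (λ z → ℕ→ℚ a ℚ.+ z ℚ.+ ℕ→ℚ c ℚ.* ℕ→ℚ y) (ℕ→ℚ-* b x) ⟩
  ℕ→ℚ a ℚ.+ ℕ→ℚ b ℚ.* ℕ→ℚ x ℚ.+ ℕ→ℚ c ℚ.* ℕ→ℚ y     ∎)
  where open ≡-Reasoning

pow2≡/ : ∀ e a b → e ≡ ℤ.+ a ℤ.- ℤ.+ b → pow2 e ≡ _/_ (ℤ.+ (2 ^ a)) (2 ^ b) {{ℕ.m^n≢0 2 b}}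
pow2≡/ (ℤ.+ c) a b e≡a-b = /-cong-≃ (ℤ.+ (2 ^ c)) 1 (ℤ.+ (2 ^ a)) (2 ^ b) {{_}} {{ℕ.m^n≢0 2 b}} (begin
  ℤ.+ (2 ^ c) ℤ.* ℤ.+ (2 ^ b)    ≡⟨ 2^-+ c b ⟩
  ℤ.+ (2 ^ (c + b))              ≡⟨ cong (λ x → ℤ.+ (2 ^ x)) c+b≡a ⟩
  ℤ.+ (2 ^ a)                    ≡⟨ sym (ℤ.*-identityʳ _) ⟩
  ℤ.+ (2 ^ a) ℤ.* ℤ.+ 1          ∎)
  where
  open ≡-Reasoning
  c+b≡a : c + b ≡ a
  c+b≡a = ℤ.+-injective (trans (ℤ.pos-+ c b) (trans (cong (ℤ._+ ℤ.+ b) e≡a-b) (cancel (ℤ.+ a) (ℤ.+ b))))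
    where
    cancel : ∀ a b → a ℤ.- b ℤ.+ b ≡ a
    cancel = solve-∀
pow2≡/ -[1+ c ] a b e≡a-b = /-cong-≃ (ℤ.+ 1) (2 ^ suc c) (ℤ.+ (2 ^ a)) (2 ^ b) {{ℕ.m^n≢0 2 (suc c)}} {{ℕ.m^n≢0 2 b}} (begin
  ℤ.+ 1 ℤ.* ℤ.+ (2 ^ b)          ≡⟨ ℤ.*-identityˡ _ ⟩
  ℤ.+ (2 ^ b)                    ≡⟨ cong (λ x → ℤ.+ (2 ^ x)) (sym 1+c+a≡b) ⟩
  ℤ.+ (2 ^ (suc c + a))          ≡⟨ sym (2^-+ (suc c) a) ⟩
  ℤ.+ (2 ^ suc c) ℤ.* ℤ.+ (2 ^ a) ≡⟨ ℤ.*-comm (ℤ.+ (2 ^ suc c)) (ℤ.+ (2 ^ a)) ⟩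
  ℤ.+ (2 ^ a) ℤ.* ℤ.+ (2 ^ suc c) ∎)
  where
  open ≡-Reasoning
  1+c+a≡b : suc c + a ≡ b
  1+c+a≡b = ℤ.+-injective (trans (ℤ.pos-+ (suc c) a) (trans (cong (λ x → ℤ.- x ℤ.+ ℤ.+ a) e≡a-b) (cancel (ℤ.+ a) (ℤ.+ b))))
    where
    cancel : ∀ a b → ℤ.- (a ℤ.- b) ℤ.+ a ≡ b
    cancel = solve-∀

module ModularArithmetic (N : ℕ) .{{N≢0 : NonZero N}} where

  open ZMod N {{N≢0}} public
    renaming (_⊕_ to infixl 6 _⊕_; _⊗_ to infixl 7 _⊗_; ⊖_ to infix 8 ⊖_)
  open import Algebra.Definitions {A = Zn} _≡_
    using (Commutative; Associative; LeftIdentity; LeftInverse; _DistributesOverʳ_)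

  reduce : ℕ → Zn
  reduce x = x mod N

  toℕ-reduce : ∀ x → toℕ (reduce x) ≡ x % N
  toℕ-reduce x = toℕ-fromℕ< _

  reduce-toℕ : ∀ a → reduce (toℕ a) ≡ a
  reduce-toℕ a = toℕ-injective (trans (toℕ-reduce (toℕ a)) (m<n⇒m%n≡m (toℕ<n a)))

  reduce-cong-% : ∀ {x y} → x % N ≡ y % N → reduce x ≡ reduce y
  reduce-cong-% {x} {y} eq = toℕ-injective (trans (toℕ-reduce x) (trans eq (sym (toℕ-reduce y))))

  reduce-+ : ∀ x y → reduce (x + y) ≡ reduce x ⊕ reduce y
  reduce-+ x y = reduce-cong-% (trans (%-distribˡ-+ x y N)
    (sym (cong₂ (λ a b → (a + b) % N) (toℕ-reduce x) (toℕ-reduce y))))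

  reduce-* : ∀ x y → reduce (x * y) ≡ reduce x ⊗ reduce y
  reduce-* x y = reduce-cong-% (trans (%-distribˡ-* x y N)
    (sym (cong₂ (λ a b → (a * b) % N) (toℕ-reduce x) (toℕ-reduce y))))

  reduce-N : reduce N ≡ 𝟘
  reduce-N = reduce-cong-% (trans (n%n≡0 N) (sym (m<n⇒m%n≡m (>-nonZero⁻¹ N))))

  reduce-+ˡ : ∀ x a → reduce x ⊕ a ≡ reduce (x + toℕ a)
  reduce-+ˡ x a = trans (cong (reduce x ⊕_) (sym (reduce-toℕ a))) (sym (reduce-+ x (toℕ a)))

  reduce-+ʳ : ∀ a x → a ⊕ reduce x ≡ reduce (toℕ a + x)
  reduce-+ʳ a x = trans (cong (_⊕ reduce x) (sym (reduce-toℕ a))) (sym (reduce-+ (toℕ a) x))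

  reduce-*ˡ : ∀ x a → reduce x ⊗ a ≡ reduce (x * toℕ a)
  reduce-*ˡ x a = trans (cong (reduce x ⊗_) (sym (reduce-toℕ a))) (sym (reduce-* x (toℕ a)))

  reduce-*ʳ : ∀ a x → a ⊗ reduce x ≡ reduce (toℕ a * x)
  reduce-*ʳ a x = trans (cong (_⊗ reduce x) (sym (reduce-toℕ a))) (sym (reduce-* (toℕ a) x))

  ⊕-comm : Commutative _⊕_
  ⊕-comm a b = cong reduce (ℕ.+-comm (toℕ a) (toℕ b))

  ⊗-comm : Commutative _⊗_
  ⊗-comm a b = cong reduce (ℕ.*-comm (toℕ a) (toℕ b))

  ⊕-assoc : Associative _⊕_
  ⊕-assoc a b c = begin
    (a ⊕ b) ⊕ c               ≡⟨ reduce-+ˡ (toℕ a + toℕ b) c ⟩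
    reduce (toℕ a + toℕ b + toℕ c) ≡⟨ cong reduce (ℕ.+-assoc (toℕ a) (toℕ b) (toℕ c)) ⟩
    reduce (toℕ a + (toℕ b + toℕ c)) ≡⟨ sym (reduce-+ʳ a (toℕ b + toℕ c)) ⟩
    a ⊕ (b ⊕ c)               ∎
    where open ≡-Reasoning

  ⊗-assoc : Associative _⊗_
  ⊗-assoc a b c = begin
    (a ⊗ b) ⊗ c               ≡⟨ reduce-*ˡ (toℕ a * toℕ b) c ⟩
    reduce (toℕ a * toℕ b * toℕ c) ≡⟨ cong reduce (ℕ.*-assoc (toℕ a) (toℕ b) (toℕ c)) ⟩
    reduce (toℕ a * (toℕ b * toℕ c)) ≡⟨ sym (reduce-*ʳ a (toℕ b * toℕ c)) ⟩
    a ⊗ (b ⊗ c)               ∎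
    where open ≡-Reasoning

  ⊕-identityˡ : LeftIdentity 𝟘 _⊕_
  ⊕-identityˡ a = trans (reduce-+ˡ 0 a) (reduce-toℕ a)

  ⊗-identityˡ : LeftIdentity 𝟙 _⊗_
  ⊗-identityˡ a = trans (reduce-*ˡ 1 a) (trans (cong reduce (ℕ.*-identityˡ (toℕ a))) (reduce-toℕ a))

  ⊖-inverseˡ : LeftInverse 𝟘 ⊖_ _⊕_
  ⊖-inverseˡ a = trans (reduce-+ˡ (N ∸ toℕ a) a) (trans (cong reduce (ℕ.m∸n+n≡m (ℕ.<⇒≤ (toℕ<n a)))) reduce-N)

  ⊗-distribʳ-⊕ : _⊗_ DistributesOverʳ _⊕_
  ⊗-distribʳ-⊕ a b c = begin
    (b ⊕ c) ⊗ a                          ≡⟨ reduce-*ˡ (toℕ b + toℕ c) a ⟩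
    reduce ((toℕ b + toℕ c) * toℕ a)     ≡⟨ cong reduce (ℕ.*-distribʳ-+ (toℕ a) (toℕ b) (toℕ c)) ⟩
    reduce (toℕ b * toℕ a + toℕ c * toℕ a) ≡⟨ reduce-+ (toℕ b * toℕ a) (toℕ c * toℕ a) ⟩
    (b ⊗ a) ⊕ (c ⊗ a)                    ∎
    where open ≡-Reasoning

  isCommutativeRing : IsCommutativeRing _≡_ _⊕_ _⊗_ ⊖_ 𝟘 𝟙
  isCommutativeRing = record
    { isRing = record
      { +-isAbelianGroup = record
        { isGroup = record
          { isMonoid = record
            { isSemigroup = record
              { isMagma = record { isEquivalence = isEquivalence ; ∙-cong = cong₂ _⊕_ }
              ; assoc = ⊕-assoc }
            ; identity = comm∧idˡ⇒id ⊕-comm ⊕-identityˡ }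
          ; inverse = comm∧invˡ⇒inv ⊕-comm ⊖-inverseˡ
          ; ⁻¹-cong = cong ⊖_ }
        ; comm = ⊕-comm }
      ; *-cong = cong₂ _⊗_
      ; *-assoc = ⊗-assoc
      ; *-identity = comm∧idˡ⇒id ⊗-comm ⊗-identityˡ
      ; distrib = (comm∧distrʳ⇒distrˡ ⊗-comm ⊗-distribʳ-⊕ , ⊗-distribʳ-⊕) }
    ; *-comm = ⊗-comm }

  commutativeRing : CommutativeRing 0ℓ 0ℓ
  commutativeRing = record { isCommutativeRing = isCommutativeRing }

  open import Algebra.Properties.Ring (CommutativeRing.ring commutativeRing)
    using (-‿distribˡ-*; -‿distribʳ-*)
  open import Algebra.Properties.AbelianGroup (CommutativeRing.+-abelianGroup commutativeRing)
    using (⁻¹-∙-comm; ⁻¹-anti-homo-∙; ε⁻¹≈ε; ⁻¹-involutive; xyx⁻¹≈y; inverseʳ-unique)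

  ⊖-inverseʳ : ∀ a → a ⊕ ⊖ a ≡ 𝟘
  ⊖-inverseʳ a = trans (⊕-comm a (⊖ a)) (⊖-inverseˡ a)

  ⊖-unique : ∀ a b → a ⊕ b ≡ 𝟘 → b ≡ ⊖ a
  ⊖-unique = inverseʳ-unique

  ⊖-involutive : ∀ a → ⊖ ⊖ a ≡ a
  ⊖-involutive = ⁻¹-involutive

  ⊗-zeroʳ : ∀ a → a ⊗ 𝟘 ≡ 𝟘
  ⊗-zeroʳ = CommutativeRing.zeroʳ commutativeRing

  ⊗-identityʳ : ∀ a → a ⊗ 𝟙 ≡ a
  ⊗-identityʳ = CommutativeRing.*-identityʳ commutativeRing

  fromℤ : ℤ → Zn
  fromℤ (ℤ.+ n)    = reduce n
  fromℤ -[1+ n ] = ⊖ reduce (suc n)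

  fromℤ-neg : ∀ i → fromℤ (ℤ.- i) ≡ ⊖ fromℤ i
  fromℤ-neg (ℤ.+ zero)  = sym ε⁻¹≈ε
  fromℤ-neg +[1+ n ]  = refl
  fromℤ-neg -[1+ n ]  = sym (⁻¹-involutive _)

  fromℤ-⊖ : ∀ m n → fromℤ (m ℤ.⊖ n) ≡ reduce m ⊕ ⊖ reduce n
  fromℤ-⊖ m       zero    = sym (trans (cong (reduce m ⊕_) ε⁻¹≈ε) (trans (⊕-comm (reduce m) 𝟘) (⊕-identityˡ (reduce m))))
  fromℤ-⊖ zero    (suc n) = sym (⊕-identityˡ _)
  fromℤ-⊖ (suc m) (suc n) = begin
    fromℤ (suc m ℤ.⊖ suc n)                     ≡⟨ cong fromℤ (ℤ.[1+m]⊖[1+n]≡m⊖n m n) ⟩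
    fromℤ (m ℤ.⊖ n)                             ≡⟨ fromℤ-⊖ m n ⟩
    x ⊕ ⊖ y                                     ≡⟨ sym (xyx⁻¹≈y 𝟙 (x ⊕ ⊖ y)) ⟩
    𝟙 ⊕ (x ⊕ ⊖ y) ⊕ ⊖ 𝟙                         ≡⟨ cong (_⊕ ⊖ 𝟙) (sym (⊕-assoc 𝟙 x (⊖ y))) ⟩
    (𝟙 ⊕ x) ⊕ ⊖ y ⊕ ⊖ 𝟙                         ≡⟨ ⊕-assoc (𝟙 ⊕ x) (⊖ y) (⊖ 𝟙) ⟩
    (𝟙 ⊕ x) ⊕ (⊖ y ⊕ ⊖ 𝟙)                       ≡⟨ cong ((𝟙 ⊕ x) ⊕_) (sym (⁻¹-anti-homo-∙ 𝟙 y)) ⟩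
    (𝟙 ⊕ x) ⊕ ⊖ (𝟙 ⊕ y)                         ≡⟨ sym (cong₂ (λ a b → a ⊕ ⊖ b) (reduce-+ 1 m) (reduce-+ 1 n)) ⟩
    reduce (suc m) ⊕ ⊖ reduce (suc n)           ∎
    where open ≡-Reasoning
          x = reduce m
          y = reduce n

  fromℤ-+ : ∀ i j → fromℤ (i ℤ.+ j) ≡ fromℤ i ⊕ fromℤ j
  fromℤ-+ (ℤ.+ m)    (ℤ.+ n)    = reduce-+ m n
  fromℤ-+ (ℤ.+ m)    -[1+ n ] = fromℤ-⊖ m (suc n)
  fromℤ-+ -[1+ m ] (ℤ.+ n)    = trans (fromℤ-⊖ n (suc m)) (⊕-comm (reduce n) (⊖ reduce (suc m)))
  fromℤ-+ -[1+ m ] -[1+ n ] = begin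
    ⊖ reduce (suc (suc (m + n)))                ≡⟨ cong (λ x → ⊖ reduce (suc x)) (sym (ℕ.+-suc m n)) ⟩
    ⊖ reduce (suc m + suc n)                  ≡⟨ cong ⊖_ (reduce-+ (suc m) (suc n)) ⟩
    ⊖ (reduce (suc m) ⊕ reduce (suc n))         ≡⟨ sym (⁻¹-∙-comm (reduce (suc m)) (reduce (suc n))) ⟩
    ⊖ reduce (suc m) ⊕ ⊖ reduce (suc n)         ∎
    where open ≡-Reasoning

  fromℤ-+* : ∀ m j → fromℤ (ℤ.+ m ℤ.* j) ≡ reduce m ⊗ fromℤ j
  fromℤ-+* m (ℤ.+ n)    = trans (cong fromℤ (sym (ℤ.pos-* m n))) (reduce-* m n)
  fromℤ-+* m -[1+ n ] = begin
    fromℤ (ℤ.+ m ℤ.* -[1+ n ])                    ≡⟨ cong fromℤ (sym (ℤ.neg-distribʳ-* (ℤ.+ m) (ℤ.+ suc n))) ⟩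
    fromℤ (ℤ.- (ℤ.+ m ℤ.* ℤ.+ suc n))               ≡⟨ fromℤ-neg (ℤ.+ m ℤ.* ℤ.+ suc n) ⟩
    ⊖ fromℤ (ℤ.+ m ℤ.* ℤ.+ suc n)                   ≡⟨ cong ⊖_ (fromℤ-+* m (ℤ.+ suc n)) ⟩
    ⊖ (reduce m ⊗ reduce (suc n))               ≡⟨ -‿distribʳ-* (reduce m) (reduce (suc n)) ⟩
    reduce m ⊗ ⊖ reduce (suc n)                 ∎
    where open ≡-Reasoning

  fromℤ-* : ∀ i j → fromℤ (i ℤ.* j) ≡ fromℤ i ⊗ fromℤ j
  fromℤ-* (ℤ.+ m)    j = fromℤ-+* m j
  fromℤ-* -[1+ m ] j = begin
    fromℤ (-[1+ m ] ℤ.* j)                      ≡⟨ cong fromℤ (sym (ℤ.neg-distribˡ-* (ℤ.+ suc m) j)) ⟩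
    fromℤ (ℤ.- (ℤ.+ suc m ℤ.* j))                 ≡⟨ fromℤ-neg (ℤ.+ suc m ℤ.* j) ⟩
    ⊖ fromℤ (ℤ.+ suc m ℤ.* j)                     ≡⟨ cong ⊖_ (fromℤ-+* (suc m) j) ⟩
    ⊖ (reduce (suc m) ⊗ fromℤ j)                ≡⟨ -‿distribˡ-* (reduce (suc m)) (fromℤ j) ⟩
    ⊖ reduce (suc m) ⊗ fromℤ j                  ∎
    where open ≡-Reasoning

  fromℤ-morphism : ℤ.+-*-rawRing -Raw-AlmostCommutative⟶ fromCommutativeRing commutativeRing
  fromℤ-morphism = record
    { ⟦_⟧ = fromℤ ; +-homo = fromℤ-+ ; *-homo = fromℤ-* ; -‿homo = fromℤ-neg ; 0-homo = refl ; 1-homo = refl }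

  fromℤ-≟ : ∀ i j → Maybe (fromℤ i ≡ fromℤ j)
  fromℤ-≟ i j with i ℤ.≟ j
  ... | yes i≡j = just (cong fromℤ i≡j)
  ... | no _    = nothing

  module ZnSolver = Algebra.Solver.Ring ℤ.+-*-rawRing (fromCommutativeRing commutativeRing) fromℤ-morphism fromℤ-≟

  open ZnSolver using (solve; _:+_; _:*_; :-_; con; _:=_)

  :𝟘 :𝟙 : ∀ {n} → ZnSolver.Polynomial n
  :𝟘 = con (ℤ.+ 0)
  :𝟙 = con (ℤ.+ 1)

  mulFibre : Zn → Zn → ℕ
  mulFibre t d = ∑[ b < N ] indicator (t ⊗ b ≟ᶠ d)

  module _ (p p′ : Zn) (p′p≡𝟙 : p′ ⊗ p ≡ 𝟙) where

    private
      open ≡-Reasoning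
      pp′≡𝟙 : p ⊗ p′ ≡ 𝟙
      pp′≡𝟙 = trans (⊗-comm p p′) p′p≡𝟙

    ∑-affine-unit : ∀ q (f : Zn → ℕ) → ∑[ x < N ] f (p ⊗ x ⊕ q) ≡ sum f
    ∑-affine-unit q = ∑-reindex (λ x → p ⊗ x ⊕ q) (λ y → p′ ⊗ (y ⊕ ⊖ q)) στ τσ
      where
      στ : ∀ y → p ⊗ (p′ ⊗ (y ⊕ ⊖ q)) ⊕ q ≡ y
      στ y = begin
        p ⊗ (p′ ⊗ (y ⊕ ⊖ q)) ⊕ q   ≡⟨ solve 4 (λ p p′ y q → p :* (p′ :* (y :+ :- q)) :+ q := (p :* p′) :* (y :+ :- q) :+ q) refl p p′ y q ⟩
        (p ⊗ p′) ⊗ (y ⊕ ⊖ q) ⊕ q   ≡⟨ cong (λ z → z ⊗ (y ⊕ ⊖ q) ⊕ q) pp′≡𝟙 ⟩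
        𝟙 ⊗ (y ⊕ ⊖ q) ⊕ q          ≡⟨ solve 2 (λ y q → :𝟙 :* (y :+ :- q) :+ q := y) refl y q ⟩
        y                          ∎
      τσ : ∀ x → p′ ⊗ (p ⊗ x ⊕ q ⊕ ⊖ q) ≡ x
      τσ x = begin
        p′ ⊗ (p ⊗ x ⊕ q ⊕ ⊖ q)     ≡⟨ solve 4 (λ p′ p x q → p′ :* (p :* x :+ q :+ :- q) := (p′ :* p) :* x) refl p′ p x q ⟩
        (p′ ⊗ p) ⊗ x               ≡⟨ cong (_⊗ x) p′p≡𝟙 ⟩
        𝟙 ⊗ x                      ≡⟨ ⊗-identityˡ x ⟩
        x                          ∎

    mulFibre-unit : ∀ d → mulFibre p d ≡ 1
    mulFibre-unit d = ∑-indicator-unique (λ b → p ⊗ b ≟ᶠ d) (p′ ⊗ d) (λ b → mk⇔ (to b) (from b))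
      where
      to : ∀ b → p ⊗ b ≡ d → b ≡ p′ ⊗ d
      to b pb≡d = begin
        b                ≡⟨ sym (⊗-identityˡ b) ⟩
        𝟙 ⊗ b            ≡⟨ cong (_⊗ b) (sym p′p≡𝟙) ⟩
        p′ ⊗ p ⊗ b       ≡⟨ ⊗-assoc p′ p b ⟩
        p′ ⊗ (p ⊗ b)     ≡⟨ cong (p′ ⊗_) pb≡d ⟩
        p′ ⊗ d           ∎
      from : ∀ b → b ≡ p′ ⊗ d → p ⊗ b ≡ d
      from b refl = begin
        p ⊗ (p′ ⊗ d)     ≡⟨ sym (⊗-assoc p p′ d) ⟩
        p ⊗ p′ ⊗ d       ≡⟨ cong (_⊗ d) pp′≡𝟙 ⟩
        𝟙 ⊗ d            ≡⟨ ⊗-identityˡ d ⟩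
        d                ∎

  ⊕-move : ∀ x q e → (x ⊕ q ≡ e) ⇔ (x ≡ e ⊕ ⊖ q)
  ⊕-move x q e = mk⇔
    (λ eq → trans (solve 2 (λ x q → x := x :+ q :+ :- q) refl x q) (cong (_⊕ ⊖ q) eq))
    (λ eq → trans (cong (_⊕ q) eq) (solve 2 (λ e q → e :+ :- q :+ q := e) refl e q))

  ⊕-⊖-cancel : ∀ c e → c ⊕ e ⊕ ⊖ c ≡ e
  ⊕-⊖-cancel c e = solve 2 (λ c e → c :+ e :+ :- c := e) refl c e

  ⊖𝟙²≡𝟙 : ⊖ 𝟙 ⊗ ⊖ 𝟙 ≡ 𝟙
  ⊖𝟙²≡𝟙 = solve 0 (:- :𝟙 :* :- :𝟙 := :𝟙) refl

  ∑-translate : ∀ c (f : Zn → ℕ) → ∑[ x < N ] f (c ⊕ x) ≡ sum f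
  ∑-translate c = ∑-reindex (c ⊕_) (_⊕ ⊖ c)
    (λ y → solve 2 (λ c y → c :+ (y :+ :- c) := y) refl c y)
    (λ x → solve 2 (λ c x → c :+ x :+ :- c := x) refl c x)

module ProductMatrices (N : ℕ) .{{N≢0 : NonZero N}} where

  open ModularArithmetic N {{N≢0}} public
  open ZnSolver using (solve; _:+_; _:*_; :-_; con; _:=_)

  m₁₁ m₁₂ m₂₁ m₂₂ : ∀ {n} → Vec Zn n → Zn
  m₁₁ v = proj₁ (proj₁ (M v))
  m₁₂ v = proj₂ (proj₁ (M v))
  m₂₁ v = proj₁ (proj₂ (M v))
  m₂₂ v = proj₂ (proj₂ (M v))

  m₁₁-∷ : ∀ {n} a (v : Vec Zn n) → m₁₁ (a ∷ v) ≡ m₁₁ v ⊗ a ⊕ m₁₂ v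
  m₁₁-∷ a v = solve 3 (λ p q a → p :* a :+ q :* :𝟙 := p :* a :+ q) refl (m₁₁ v) (m₁₂ v) a

  m₁₂-∷ : ∀ {n} a (v : Vec Zn n) → m₁₂ (a ∷ v) ≡ ⊖ m₁₁ v
  m₁₂-∷ a v = solve 2 (λ p q → p :* (:- :𝟙) :+ q :* :𝟘 := :- p) refl (m₁₁ v) (m₁₂ v)

  det-M : ∀ {n} (v : Vec Zn n) → m₁₁ v ⊗ m₂₂ v ⊕ ⊖ (m₁₂ v ⊗ m₂₁ v) ≡ 𝟙
  det-M []      = solve 0 (:𝟙 :* :𝟙 :+ :- (:𝟘 :* :𝟘) := :𝟙) refl
  det-M (a ∷ v) = trans (solve 5 (λ p q r s a →
      (p :* a :+ q :* :𝟙) :* (r :* (:- :𝟙) :+ s :* :𝟘) :+ :- ((p :* (:- :𝟙) :+ q :* :𝟘) :* (r :* a :+ s :* :𝟙))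
        := p :* s :+ :- (q :* r)) refl (m₁₁ v) (m₁₂ v) (m₂₁ v) (m₂₂ v) a)
    (det-M v)

  -- The row (p, q) multiplied by T b and then T a, written exactly as _·_ unfolds.
  rowT₁ : Zn → Zn → Zn → Zn → Zn
  rowT₁ p q b a = (p ⊗ b ⊕ q ⊗ 𝟙) ⊗ a ⊕ (p ⊗ ⊖ 𝟙 ⊕ q ⊗ 𝟘) ⊗ 𝟙

  rowT₂ : Zn → Zn → Zn → Zn
  rowT₂ p q b = (p ⊗ b ⊕ q ⊗ 𝟙) ⊗ ⊖ 𝟙 ⊕ (p ⊗ ⊖ 𝟙 ⊕ q ⊗ 𝟘) ⊗ 𝟘

  private
    :rowT₁ : ∀ {n} → (p q b a : ZnSolver.Polynomial n) → ZnSolver.Polynomial n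
    :rowT₁ p q b a = (p :* b :+ q :* :𝟙) :* a :+ (p :* (:- :𝟙) :+ q :* :𝟘) :* :𝟙

    :rowT₂ : ∀ {n} → (p q b : ZnSolver.Polynomial n) → ZnSolver.Polynomial n
    :rowT₂ p q b = (p :* b :+ q :* :𝟙) :* (:- :𝟙) :+ (p :* (:- :𝟙) :+ q :* :𝟘) :* :𝟘

  scalar : Zn → Mat
  scalar e = (e , 𝟘) , (𝟘 , e)

  scal-Id : ∀ e → scal e Id ≡ scalar e
  scal-Id e = cong₂ _,_ (cong₂ _,_ (⊗-identityʳ e) (⊗-zeroʳ e)) (cong₂ _,_ (⊗-zeroʳ e) (⊗-identityʳ e))

  -- A row (p, q) of M u becomes ((pb + q)a − p, −(pb + q)) in M (a ∷ b ∷ u). Matching the rows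
  -- of e·Id determines p, b and a; conversely the last entry is then forced by det M u = 1.
  module _ {e : Zn} (e²≡𝟙 : e ⊗ e ≡ 𝟙) where

    private
      open ≡-Reasoning
      e²-cancel : ∀ x → (e ⊗ e ⊕ ⊖ 𝟙) ⊗ x ≡ 𝟘
      e²-cancel x = begin
        (e ⊗ e ⊕ ⊖ 𝟙) ⊗ x ≡⟨ cong (λ y → (y ⊕ ⊖ 𝟙) ⊗ x) e²≡𝟙 ⟩
        (𝟙 ⊕ ⊖ 𝟙) ⊗ x     ≡⟨ solve 1 (λ x → (:𝟙 :+ :- :𝟙) :* x := :𝟘) refl x ⟩
        𝟘                 ∎

    row₁-scalar⇒ : ∀ {p q b a} → rowT₁ p q b a ≡ e → rowT₂ p q b ≡ 𝟘 → p ≡ ⊖ e × b ≡ e ⊗ q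
    row₁-scalar⇒ {p} {q} {b} {a} r₁≡e r₂≡𝟘 = p≡-e , b≡eq
      where
      p≡-e : p ≡ ⊖ e
      p≡-e = begin
        p                                     ≡⟨ solve 4 (λ p q b a → p := :- :rowT₁ p q b a :+ :- (:rowT₂ p q b :* a)) refl p q b a ⟩
        ⊖ rowT₁ p q b a ⊕ ⊖ (rowT₂ p q b ⊗ a) ≡⟨ cong₂ (λ x y → ⊖ x ⊕ ⊖ (y ⊗ a)) r₁≡e r₂≡𝟘 ⟩
        ⊖ e ⊕ ⊖ (𝟘 ⊗ a)                       ≡⟨ solve 2 (λ e a → :- e :+ :- (:𝟘 :* a) := :- e) refl e a ⟩
        ⊖ e                                   ∎
      b≡eq : b ≡ e ⊗ q
      b≡eq = begin
        b                                     ≡⟨ solve 3 (λ e q b → b := e :* q :+ e :* :rowT₂ (:- e) q b :+ :- ((e :* e :+ :- :𝟙) :* b)) refl e q b ⟩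
        e ⊗ q ⊕ e ⊗ rowT₂ (⊖ e) q b ⊕ ⊖ ((e ⊗ e ⊕ ⊖ 𝟙) ⊗ b)
                                              ≡⟨ cong₂ (λ x y → e ⊗ q ⊕ e ⊗ x ⊕ ⊖ y) (subst (λ x → rowT₂ x q b ≡ 𝟘) p≡-e r₂≡𝟘) (e²-cancel b) ⟩
        e ⊗ q ⊕ e ⊗ 𝟘 ⊕ ⊖ 𝟘                   ≡⟨ solve 2 (λ e q → e :* q :+ e :* :𝟘 :+ :- :𝟘 := e :* q) refl e q ⟩
        e ⊗ q                                 ∎

    row₂-scalar⇒ : ∀ {r s b a} → rowT₁ r s b a ≡ 𝟘 → rowT₂ r s b ≡ e → a ≡ ⊖ e ⊗ r
    row₂-scalar⇒ {r} {s} {b} {a} r₁≡𝟘 r₂≡e = begin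
      a                                       ≡⟨ solve 5 (λ e r s b a → a := :- e :* r :+ :- e :* :rowT₁ r s b a
                                                   :+ :- e :* (:rowT₂ r s b :+ :- e) :* a :+ :- ((e :* e :+ :- :𝟙) :* a)) refl e r s b a ⟩
      ⊖ e ⊗ r ⊕ ⊖ e ⊗ rowT₁ r s b a ⊕ ⊖ e ⊗ (rowT₂ r s b ⊕ ⊖ e) ⊗ a ⊕ ⊖ ((e ⊗ e ⊕ ⊖ 𝟙) ⊗ a)
                                              ≡⟨ cong₂ (λ x y → ⊖ e ⊗ r ⊕ ⊖ e ⊗ x ⊕ ⊖ e ⊗ (y ⊕ ⊖ e) ⊗ a ⊕ ⊖ ((e ⊗ e ⊕ ⊖ 𝟙) ⊗ a)) r₁≡𝟘 r₂≡e ⟩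
      ⊖ e ⊗ r ⊕ ⊖ e ⊗ 𝟘 ⊕ ⊖ e ⊗ (e ⊕ ⊖ e) ⊗ a ⊕ ⊖ ((e ⊗ e ⊕ ⊖ 𝟙) ⊗ a)
                                              ≡⟨ cong (λ z → ⊖ e ⊗ r ⊕ ⊖ e ⊗ 𝟘 ⊕ ⊖ e ⊗ (e ⊕ ⊖ e) ⊗ a ⊕ ⊖ z) (e²-cancel a) ⟩
      ⊖ e ⊗ r ⊕ ⊖ e ⊗ 𝟘 ⊕ ⊖ e ⊗ (e ⊕ ⊖ e) ⊗ a ⊕ ⊖ 𝟘
                                              ≡⟨ solve 3 (λ e r a → :- e :* r :+ :- e :* :𝟘 :+ :- e :* (e :+ :- e) :* a :+ :- :𝟘 := :- e :* r) refl e r a ⟩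
      ⊖ e ⊗ r                                 ∎

    row₁-scalar⇐ : ∀ q a → rowT₁ (⊖ e) q (e ⊗ q) a ≡ e × rowT₂ (⊖ e) q (e ⊗ q) ≡ 𝟘
    row₁-scalar⇐ q a = r₁ , r₂
      where
      r₁ : rowT₁ (⊖ e) q (e ⊗ q) a ≡ e
      r₁ = begin
        rowT₁ (⊖ e) q (e ⊗ q) a           ≡⟨ solve 3 (λ e q a → :rowT₁ (:- e) q (e :* q) a := e :+ :- ((e :* e :+ :- :𝟙) :* (q :* a))) refl e q a ⟩
        e ⊕ ⊖ ((e ⊗ e ⊕ ⊖ 𝟙) ⊗ (q ⊗ a))   ≡⟨ cong (λ x → e ⊕ ⊖ x) (e²-cancel (q ⊗ a)) ⟩
        e ⊕ ⊖ 𝟘                           ≡⟨ solve 1 (λ e → e :+ :- :𝟘 := e) refl e ⟩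
        e                                 ∎
      r₂ : rowT₂ (⊖ e) q (e ⊗ q) ≡ 𝟘
      r₂ = trans (solve 2 (λ e q → :rowT₂ (:- e) q (e :* q) := (e :* e :+ :- :𝟙) :* q) refl e q) (e²-cancel q)

    row₂-scalar⇐ : ∀ q r s → ⊖ e ⊗ s ⊕ ⊖ (q ⊗ r) ≡ 𝟙 →
                   rowT₁ r s (e ⊗ q) (⊖ e ⊗ r) ≡ 𝟘 × rowT₂ r s (e ⊗ q) ≡ e
    row₂-scalar⇐ q r s det≡𝟙 = r₁ , r₂
      where
      δ = ⊖ e ⊗ s ⊕ ⊖ (q ⊗ r) ⊕ ⊖ 𝟙
      δ≡𝟘 : δ ≡ 𝟘
      δ≡𝟘 = trans (cong (_⊕ ⊖ 𝟙) det≡𝟙) (solve 0 (:𝟙 :+ :- :𝟙 := :𝟘) refl)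
      r₂ : rowT₂ r s (e ⊗ q) ≡ e
      r₂ = begin
        rowT₂ r s (e ⊗ q)                 ≡⟨ solve 4 (λ e q r s → :rowT₂ r s (e :* q)
                                               := e :+ e :* (:- e :* s :+ :- (q :* r) :+ :- :𝟙) :+ (e :* e :+ :- :𝟙) :* s) refl e q r s ⟩
        e ⊕ e ⊗ δ ⊕ (e ⊗ e ⊕ ⊖ 𝟙) ⊗ s     ≡⟨ cong₂ (λ x y → e ⊕ e ⊗ x ⊕ y) δ≡𝟘 (e²-cancel s) ⟩
        e ⊕ e ⊗ 𝟘 ⊕ 𝟘                     ≡⟨ solve 1 (λ e → e :+ e :* :𝟘 :+ :𝟘 := e) refl e ⟩
        e                                 ∎
      r₁ : rowT₁ r s (e ⊗ q) (⊖ e ⊗ r) ≡ 𝟘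
      r₁ = begin
        rowT₁ r s (e ⊗ q) (⊖ e ⊗ r)       ≡⟨ solve 4 (λ e q r s → :rowT₁ r s (e :* q) (:- e :* r)
                                               := (e :* e :+ :- :𝟙) :* r :+ (e :* (:- e :* s :+ :- (q :* r) :+ :- :𝟙) :+ (e :* e :+ :- :𝟙) :* s) :* e :* r) refl e q r s ⟩
        (e ⊗ e ⊕ ⊖ 𝟙) ⊗ r ⊕ (e ⊗ δ ⊕ (e ⊗ e ⊕ ⊖ 𝟙) ⊗ s) ⊗ e ⊗ r
                                          ≡⟨ cong₂ (λ x y → x ⊕ (e ⊗ y ⊕ (e ⊗ e ⊕ ⊖ 𝟙) ⊗ s) ⊗ e ⊗ r) (e²-cancel r) δ≡𝟘 ⟩
        𝟘 ⊕ (e ⊗ 𝟘 ⊕ (e ⊗ e ⊕ ⊖ 𝟙) ⊗ s) ⊗ e ⊗ r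
                                          ≡⟨ cong (λ z → 𝟘 ⊕ (e ⊗ 𝟘 ⊕ z) ⊗ e ⊗ r) (e²-cancel s) ⟩
        𝟘 ⊕ (e ⊗ 𝟘 ⊕ 𝟘) ⊗ e ⊗ r            ≡⟨ solve 2 (λ e r → :𝟘 :+ (e :* :𝟘 :+ :𝟘) :* e :* r := :𝟘) refl e r ⟩
        𝟘                                 ∎

    M-∷∷≡scalar⇔ : ∀ {n} (u : Vec Zn n) b a →
                   M (a ∷ b ∷ u) ≡ scalar e ⇔ (m₁₁ u ≡ ⊖ e × b ≡ e ⊗ m₁₂ u × a ≡ ⊖ e ⊗ m₂₁ u)
    M-∷∷≡scalar⇔ u b a = mk⇔ to from
      where
      to : M (a ∷ b ∷ u) ≡ scalar e → m₁₁ u ≡ ⊖ e × b ≡ e ⊗ m₁₂ u × a ≡ ⊖ e ⊗ m₂₁ u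
      to eq = let p≡-e , b≡eq = row₁-scalar⇒ {m₁₁ u} {m₁₂ u} {b} {a} (cong (proj₁ ∘ proj₁) eq) (cong (proj₂ ∘ proj₁) eq) in
              p≡-e , b≡eq , row₂-scalar⇒ {m₂₁ u} {m₂₂ u} {b} {a} (cong (proj₁ ∘ proj₂) eq) (cong (proj₂ ∘ proj₂) eq)
      from : ∀ {b a} → m₁₁ u ≡ ⊖ e × b ≡ e ⊗ m₁₂ u × a ≡ ⊖ e ⊗ m₂₁ u → M (a ∷ b ∷ u) ≡ scalar e
      from (p≡-e , refl , refl) = cong₂ _,_
          (cong₂ _,_ (trans (cong (λ p → rowT₁ p q (e ⊗ q) (⊖ e ⊗ r)) p≡-e) (proj₁ row₁))
                     (trans (cong (λ p → rowT₂ p q (e ⊗ q)) p≡-e) (proj₂ row₁)))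
          (cong₂ _,_ (proj₁ row₂) (proj₂ row₂))
        where
        q = m₁₂ u
        r = m₂₁ u
        row₁ = row₁-scalar⇐ q (⊖ e ⊗ r)
        row₂ = row₂-scalar⇐ q r (m₂₂ u) (subst (λ p → p ⊗ m₂₂ u ⊕ ⊖ (q ⊗ r) ≡ 𝟙) p≡-e (det-M u))

  sum-map-allVecs : ∀ n (g : Vec Zn n → ℕ) → sumˡ (List.map g (allVecs n)) ≡ ∑ᵛ n g
  sum-map-allVecs zero    g = ℕ.+-identityʳ (g [])
  sum-map-allVecs (suc n) g = begin
    sumˡ (List.map g (List.concatMap (λ v → List.map (_∷ v) (allFin N)) (allVecs n)))
      ≡⟨ sum-concatMap _ g (allVecs n) ⟩
    sumˡ (List.map (λ v → sumˡ (List.map g (List.map (_∷ v) (allFin N)))) (allVecs n))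
      ≡⟨ cong sumˡ (List.map-cong (λ v → cong sumˡ (sym (List.map-∘ (allFin N)))) (allVecs n)) ⟩
    sumˡ (List.map (λ v → sumˡ (List.map (λ a → g (a ∷ v)) (allFin N))) (allVecs n))
      ≡⟨ cong sumˡ (List.map-cong (λ v → sum-map-tabulate (λ a → a) (λ a → g (a ∷ v))) (allVecs n)) ⟩
    sumˡ (List.map (λ v → ∑[ a < N ] g (a ∷ v)) (allVecs n))
      ≡⟨ sum-map-allVecs n _ ⟩
    ∑ᵛ (suc n) g ∎
    where open ≡-Reasoning

  count≡∑ᵛ : ∀ n X → count n X ≡ ∑ᵛ n (λ v → indicator (M v ≟M X))
  count≡∑ᵛ n X = trans (length-filter≡sum-indicator (λ v → M v ≟M X) (allVecs n)) (sum-map-allVecs n _)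

  fibre₁₁ : ℕ → Zn → ℕ
  fibre₁₁ n c = ∑ᵛ n (λ u → indicator (m₁₁ u ≟ᶠ c))

  count-scalar : ∀ {e} → e ⊗ e ≡ 𝟙 → ∀ n → count (2 + n) (scalar e) ≡ fibre₁₁ n (⊖ e)
  count-scalar {e} e²≡𝟙 n = trans (count≡∑ᵛ (2 + n) (scalar e)) (∑ᵛ-cong n two-step)
    where
    two-step : ∀ u → ∑[ b < N ] ∑[ a < N ] indicator (M (a ∷ b ∷ u) ≟M scalar e) ≡ indicator (m₁₁ u ≟ᶠ ⊖ e)
    two-step u with m₁₁ u ≟ᶠ ⊖ e
    ... | yes p≡-e = ∑∑-indicator-unique (λ b a → M (a ∷ b ∷ u) ≟M scalar e) (e ⊗ m₁₂ u) (⊖ e ⊗ m₂₁ u)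
                       (λ b a → mk⇔ (proj₂ ∘ Equivalence.to (M-∷∷≡scalar⇔ e²≡𝟙 u b a))
                                    (λ ba → Equivalence.from (M-∷∷≡scalar⇔ e²≡𝟙 u b a) (p≡-e , ba)))
    ... | no p≢-e  = trans (sum-cong-≗ (λ b → ∑-indicator-⊥ (λ a → M (a ∷ b ∷ u) ≟M scalar e)
                                          (λ a → p≢-e ∘ proj₁ ∘ Equivalence.to (M-∷∷≡scalar⇔ e²≡𝟙 u b a))))
                           (sum-replicate-zero N)

  fibre₁₁-1 : ∀ c → fibre₁₁ 1 c ≡ 1
  fibre₁₁-1 c = ∑-indicator-unique (λ a → m₁₁ (a ∷ []) ≟ᶠ c) c (λ a → mk⇔ (trans (sym (m₁₁-[a] a))) (trans (m₁₁-[a] a)))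
    where
    m₁₁-[a] : ∀ a → m₁₁ (a ∷ []) ≡ a
    m₁₁-[a] a = solve 1 (λ a → :𝟙 :* a :+ :𝟘 :* :𝟙 := a) refl a

  ∑ᵛ-by-m₁₁ : ∀ n (g : Zn → ℕ) → ∑ᵛ n (λ u → g (m₁₁ u)) ≡ ∑[ c < N ] (fibre₁₁ n c * g c)
  ∑ᵛ-by-m₁₁ n g = begin
    ∑ᵛ n (λ u → g (m₁₁ u))                                        ≡⟨ ∑ᵛ-cong n (λ u → sym (∑-δ (m₁₁ u) g)) ⟩
    ∑ᵛ n (λ u → ∑[ c < N ] (indicator (c ≟ᶠ m₁₁ u) * g c))        ≡⟨ ∑ᵛ-comm-∑ n (λ u c → indicator (c ≟ᶠ m₁₁ u) * g c) ⟩
    ∑[ c < N ] ∑ᵛ n (λ u → indicator (c ≟ᶠ m₁₁ u) * g c)          ≡⟨ sum-cong-≗ (λ c → ∑ᵛ-cong n (λ u → ℕ.*-comm _ (g c))) ⟩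
    ∑[ c < N ] ∑ᵛ n (λ u → g c * indicator (c ≟ᶠ m₁₁ u))          ≡⟨ sum-cong-≗ (λ c → *-distribˡ-∑ᵛ n (g c) _) ⟩
    ∑[ c < N ] (g c * ∑ᵛ n (λ u → indicator (c ≟ᶠ m₁₁ u)))        ≡⟨ sum-cong-≗ (λ c → ℕ.*-comm (g c) _) ⟩
    ∑[ c < N ] (∑ᵛ n (λ u → indicator (c ≟ᶠ m₁₁ u)) * g c)        ≡⟨ sum-cong-≗ (λ c → cong (_* g c) (∑ᵛ-cong n (λ u →
                                                                       indicator-cong (c ≟ᶠ m₁₁ u) (m₁₁ u ≟ᶠ c) (mk⇔ sym sym)))) ⟩
    ∑[ c < N ] (fibre₁₁ n c * g c)                                ∎
    where open ≡-Reasoning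

  -- From m₁₁ (b ∷ b′ ∷ w) = m₁₁ (b′ ∷ w) ⊗ b ⊖ m₁₁ w.
  fibre₁₁-∷∷ : ∀ n c → fibre₁₁ (2 + n) c ≡ ∑ᵛ n (λ w → ∑[ b′ < N ] mulFibre (m₁₁ (b′ ∷ w)) (c ⊕ m₁₁ w))
  fibre₁₁-∷∷ n c = ∑ᵛ-cong n (λ w → sum-cong-≗ (λ b′ → sum-cong-≗ (λ b →
    indicator-cong (m₁₁ (b ∷ b′ ∷ w) ≟ᶠ c) (m₁₁ (b′ ∷ w) ⊗ b ≟ᶠ c ⊕ m₁₁ w) (solve-for-b w b′ b))))
    where
    solve-for-b : ∀ {n} (w : Vec Zn n) b′ b → (m₁₁ (b ∷ b′ ∷ w) ≡ c) ⇔ (m₁₁ (b′ ∷ w) ⊗ b ≡ c ⊕ m₁₁ w)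
    solve-for-b w b′ b = subst₂ (λ x y → (x ≡ c) ⇔ (m₁₁ (b′ ∷ w) ⊗ b ≡ c ⊕ y))
      (sym (trans (m₁₁-∷ b (b′ ∷ w)) (cong (m₁₁ (b′ ∷ w) ⊗ b ⊕_) (m₁₂-∷ b′ w)))) (⊖-involutive (m₁₁ w))
      (⊕-move (m₁₁ (b′ ∷ w) ⊗ b) (⊖ m₁₁ w) c)

module EvenModulus (h : ℕ) .{{h≢0 : NonZero h}} where

  N : ℕ
  N = 2 * h

  instance
    N≢0 : NonZero N
    N≢0 = ℕ.m*n≢0 2 h {{_}} {{h≢0}}

  open ProductMatrices N {{N≢0}} public

  odd : Zn → ℕ
  odd a = toℕ a % 2

  even : Zn → ℕ
  even a = 1 ∸ odd a

  odd-reduce : ∀ x → odd (reduce x) ≡ x % 2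
  odd-reduce x = trans (cong (_% 2) (toℕ-reduce x)) (m∣n⇒o%n%m≡o%m 2 N x (divides h (ℕ.*-comm 2 h)))

  odd-⊕ : ∀ a b → odd (a ⊕ b) ≡ (odd a + odd b) % 2
  odd-⊕ a b = trans (odd-reduce _) (%-distribˡ-+ (toℕ a) (toℕ b) 2)

  odd-⊗ : ∀ a b → odd (a ⊗ b) ≡ (odd a * odd b) % 2
  odd-⊗ a b = trans (odd-reduce _) (%-distribˡ-* (toℕ a) (toℕ b) 2)

  odd-𝟘 : odd 𝟘 ≡ 0
  odd-𝟘 = odd-reduce 0

  odd-𝟙 : odd 𝟙 ≡ 1
  odd-𝟙 = odd-reduce 1

  odd-cases : ∀ a → odd a ≡ 0 ⊎ odd a ≡ 1
  odd-cases a = %2-cases (toℕ a)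

  odd≤1 : ∀ a → odd a ≤ 1
  odd≤1 a = ℕ.<⇒≤pred (m%n<n (toℕ a) 2)

  odd-⊖-⊕ : ∀ a → (odd (⊖ a) + odd a) % 2 ≡ 0
  odd-⊖-⊕ a = trans (sym (odd-⊕ (⊖ a) a)) (trans (cong odd (⊖-inverseˡ a)) odd-𝟘)

  odd-⊖ : ∀ a → odd (⊖ a) ≡ odd a
  odd-⊖ a with odd-cases (⊖ a) | odd-cases a
  ... | inj₁ p | inj₁ q = trans p (sym q)
  ... | inj₂ p | inj₂ q = trans p (sym q)
  ... | inj₁ p | inj₂ q = contradiction (subst₂ (λ x y → (x + y) % 2 ≡ 0) p q (odd-⊖-⊕ a)) λ ()
  ... | inj₂ p | inj₁ q = contradiction (subst₂ (λ x y → (x + y) % 2 ≡ 0) p q (odd-⊖-⊕ a)) λ ()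

  odd-⊗-odd : ∀ p b → odd p ≡ 1 → odd (p ⊗ b) ≡ odd b
  odd-⊗-odd p b p-odd = begin
    odd (p ⊗ b)             ≡⟨ odd-⊗ p b ⟩
    (odd p * odd b) % 2     ≡⟨ cong (λ x → (x * odd b) % 2) p-odd ⟩
    (odd b + 0) % 2         ≡⟨ cong (_% 2) (ℕ.+-identityʳ (odd b)) ⟩
    odd b % 2               ≡⟨ m%n%n≡m%n (toℕ b) 2 ⟩
    odd b                   ∎
    where open ≡-Reasoning

  odd-affine-odd : ∀ p b q → odd p ≡ 1 → odd (p ⊗ b ⊕ q) ≡ (odd b + odd q) % 2
  odd-affine-odd p b q p-odd = trans (odd-⊕ (p ⊗ b) q) (cong (λ x → (x + odd q) % 2) (odd-⊗-odd p b p-odd))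

  odd-affine-even : ∀ p b q → odd p ≡ 0 → odd q ≡ 1 → odd (p ⊗ b ⊕ q) ≡ 1
  odd-affine-even p b q p-even q-odd =
    trans (odd-⊕ (p ⊗ b) q) (cong₂ (λ x y → (x + y) % 2) (trans (odd-⊗ p b) (cong (λ x → (x * odd b) % 2) p-even)) q-odd)

  ∑-odd-shift : ∀ c → ∑[ b < N ] ((odd b + c) % 2) ≡ h
  ∑-odd-shift = ∑-parity-shift h

  ∑-odd : ∑[ b < N ] odd b ≡ h
  ∑-odd = trans (sum-cong-≗ (λ b → sym (trans (cong (_% 2) (ℕ.+-identityʳ (odd b))) (m%n%n≡m%n (toℕ b) 2))))
                (∑-odd-shift 0)

  ∑-even : ∑[ b < N ] even b ≡ h
  ∑-even = trans (sum-cong-≗ even≡) (∑-odd-shift 1)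
    where
    even≡ : ∀ b → even b ≡ (odd b + 1) % 2
    even≡ b with odd-cases b
    ... | inj₁ b-even rewrite b-even = refl
    ... | inj₂ b-odd  rewrite b-odd  = refl

  m₁₁-or-m₁₂-odd : ∀ {n} (v : Vec Zn n) → odd (m₁₁ v) ≡ 1 ⊎ odd (m₁₂ v) ≡ 1
  m₁₁-or-m₁₂-odd []      = inj₁ odd-𝟙
  m₁₁-or-m₁₂-odd (a ∷ v) with odd-cases (m₁₁ v) | m₁₁-or-m₁₂-odd v
  ... | inj₂ p-odd  | _          = inj₂ (trans (cong odd (m₁₂-∷ a v)) (trans (odd-⊖ (m₁₁ v)) p-odd))
  ... | inj₁ p-even | inj₂ q-odd = inj₁ (trans (cong odd (m₁₁-∷ a v)) (odd-affine-even (m₁₁ v) a (m₁₂ v) p-even q-odd))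
  ... | inj₁ p-even | inj₁ p-odd = contradiction (trans (sym p-even) p-odd) λ ()

  m₁₁-even⇒m₁₂-odd : ∀ {n} (v : Vec Zn n) → odd (m₁₁ v) ≡ 0 → odd (m₁₂ v) ≡ 1
  m₁₁-even⇒m₁₂-odd v p-even with m₁₁-or-m₁₂-odd v
  ... | inj₁ p-odd = contradiction (trans (sym p-even) p-odd) λ ()
  ... | inj₂ q-odd = q-odd

  oddCount : ℕ → ℕ
  oddCount n = ∑ᵛ n (λ u → odd (m₁₁ u))

  oddCount-0 : oddCount 0 ≡ 1
  oddCount-0 = odd-𝟙

  oddCount-≤ : ∀ n → oddCount n ≤ N ^ n
  oddCount-≤ n = ℕ.≤-trans (∑ᵛ-mono-≤ n (λ u → odd≤1 (m₁₁ u))) (ℕ.≤-reflexive (trans (∑ᵛ-const n 1) (ℕ.*-identityʳ (N ^ n))))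

  odd-m₁₁-∷ : ∀ {n} (u : Vec Zn n) → ∑[ b < N ] odd (m₁₁ (b ∷ u)) + h * odd (m₁₁ u) ≡ N
  odd-m₁₁-∷ u with odd-cases (m₁₁ u)
  ... | inj₁ p-even = begin
    ∑[ b < N ] odd (m₁₁ (b ∷ u)) + h * odd (m₁₁ u)
      ≡⟨ cong₂ _+_ (sum-cong-≗ (λ b → trans (cong odd (m₁₁-∷ b u)) (odd-affine-even (m₁₁ u) b (m₁₂ u) p-even (m₁₁-even⇒m₁₂-odd u p-even))))
                   (cong (h *_) p-even) ⟩
    ∑[ b < N ] 1 + h * 0
      ≡⟨ cong₂ _+_ (trans (∑-const N 1) (ℕ.*-identityʳ N)) (ℕ.*-zeroʳ h) ⟩
    N + 0
      ≡⟨ ℕ.+-identityʳ N ⟩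
    N ∎
    where open ≡-Reasoning
  ... | inj₂ p-odd = begin
    ∑[ b < N ] odd (m₁₁ (b ∷ u)) + h * odd (m₁₁ u)
      ≡⟨ cong₂ _+_ (sum-cong-≗ (λ b → trans (cong odd (m₁₁-∷ b u)) (odd-affine-odd (m₁₁ u) b (m₁₂ u) p-odd))) (cong (h *_) p-odd) ⟩
    ∑[ b < N ] ((odd b + odd (m₁₂ u)) % 2) + h * 1
      ≡⟨ cong₂ _+_ (∑-odd-shift (odd (m₁₂ u))) (ℕ.*-identityʳ h) ⟩
    h + h
      ≡⟨ cong (h +_) (sym (ℕ.+-identityʳ h)) ⟩
    N ∎
    where open ≡-Reasoning

  oddCount-rec : ∀ n → oddCount (suc n) + h * oddCount n ≡ N ^ n * N
  oddCount-rec n = begin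
    oddCount (suc n) + h * oddCount n                                  ≡⟨ cong (oddCount (suc n) +_) (sym (*-distribˡ-∑ᵛ n h _)) ⟩
    oddCount (suc n) + ∑ᵛ n (λ u → h * odd (m₁₁ u))                    ≡⟨ sym (∑ᵛ-distrib-+ n _ _) ⟩
    ∑ᵛ n (λ u → ∑[ b < N ] odd (m₁₁ (b ∷ u)) + h * odd (m₁₁ u))        ≡⟨ ∑ᵛ-cong n odd-m₁₁-∷ ⟩
    ∑ᵛ n (λ _ → N)                                                     ≡⟨ ∑ᵛ-const n N ⟩
    N ^ n * N                                                          ∎
    where open ≡-Reasoning

  oddCount-grow : ∀ i c → c ≤ h * N → c * oddCount i ≤ oddCount (2 + i)
  oddCount-grow i c c≤hN = ℕ.≤-trans (ℕ.≤-trans (ℕ.*-mono-≤ c≤hN (oddCount-≤ i)) (ℕ.≤-reflexive (ℕ.*-assoc h N (N ^ i)))) hX≤U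
    where
    X = N ^ suc i
    rec : oddCount (2 + i) + h * oddCount (suc i) ≡ h * X + h * X
    rec = trans (oddCount-rec (suc i)) (trans (ℕ.*-comm X N) (trans (cong (λ z → (h + z) * X) (ℕ.+-identityʳ h)) (ℕ.*-distribʳ-+ X h h)))
    hX≤U : h * X ≤ oddCount (2 + i)
    hX≤U = ℕ.+-cancelʳ-≤ (h * oddCount (suc i)) (h * X) (oddCount (2 + i))
             (ℕ.≤-trans (ℕ.+-monoʳ-≤ (h * X) (ℕ.*-monoʳ-≤ h (oddCount-≤ (suc i)))) (ℕ.≤-reflexive (sym rec)))

  oddCount-closed : ∀ i → ℤ.+ 3 ℤ.* ℤ.+ oddCount i ≡ (ℤ.+ h) ℤ.^ i ℤ.* ((ℤ.+ 2) ℤ.^ suc i ℤ.+ ℤ.-1ℤ ℤ.^ i)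
  oddCount-closed zero    = cong (λ u → ℤ.+ 3 ℤ.* ℤ.+ u) oddCount-0
  oddCount-closed (suc i) = begin
    ℤ.+ 3 ℤ.* u₁                                               ≡⟨ eliminate-u₁ u₁ u H ⟩
    ℤ.+ 3 ℤ.* (u₁ ℤ.+ H ℤ.* u) ℤ.- H ℤ.* (ℤ.+ 3 ℤ.* u)          ≡⟨ cong₂ (λ x y → ℤ.+ 3 ℤ.* x ℤ.- H ℤ.* y) rec (oddCount-closed i) ⟩
    ℤ.+ 3 ℤ.* (P ℤ.* (H ℤ.* Hⁱ)) ℤ.- H ℤ.* (Hⁱ ℤ.* (P ℤ.+ S))  ≡⟨ collect P H Hⁱ S ⟩
    H ℤ.* Hⁱ ℤ.* (ℤ.+ 2 ℤ.* P ℤ.+ ℤ.-1ℤ ℤ.* S)                 ∎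
    where
    open ≡-Reasoning
    u₁ = ℤ.+ oddCount (suc i)
    u  = ℤ.+ oddCount i
    H  = ℤ.+ h
    Hⁱ = H ℤ.^ i
    P  = (ℤ.+ 2) ℤ.^ suc i
    S  = ℤ.-1ℤ ℤ.^ i
    eliminate-u₁ : ∀ u₁ u H → ℤ.+ 3 ℤ.* u₁ ≡ ℤ.+ 3 ℤ.* (u₁ ℤ.+ H ℤ.* u) ℤ.- H ℤ.* (ℤ.+ 3 ℤ.* u)
    eliminate-u₁ = solve-∀
    collect : ∀ P H Hⁱ S → ℤ.+ 3 ℤ.* (P ℤ.* (H ℤ.* Hⁱ)) ℤ.- H ℤ.* (Hⁱ ℤ.* (P ℤ.+ S)) ≡ H ℤ.* Hⁱ ℤ.* (ℤ.+ 2 ℤ.* P ℤ.+ ℤ.-1ℤ ℤ.* S)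
    collect = solve-∀
    rec : u₁ ℤ.+ H ℤ.* u ≡ P ℤ.* (H ℤ.* Hⁱ)
    rec = begin
      u₁ ℤ.+ H ℤ.* u                       ≡⟨ cong (ℤ._+_ u₁) (sym (ℤ.pos-* h (oddCount i))) ⟩
      ℤ.+ (oddCount (suc i) + h * oddCount i) ≡⟨ cong ℤ.+_ (trans (oddCount-rec i) (ℕ.*-comm (N ^ i) N)) ⟩
      ℤ.+ (N ^ suc i)                      ≡⟨ pos-^ N (suc i) ⟩
      (ℤ.+ N) ℤ.^ suc i                      ≡⟨ cong (ℤ._^ suc i) (ℤ.pos-* 2 h) ⟩
      (ℤ.+ 2 ℤ.* H) ℤ.^ suc i              ≡⟨ ^-distribʳ-* (ℤ.+ 2) H (suc i) ⟩
      P ℤ.* (H ℤ.* Hⁱ)                     ∎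

module TwoPowerModulus (k : ℕ) where

  h : ℕ
  h = 2 ^ k

  instance
    h≢0 : NonZero h
    h≢0 = ℕ.m^n≢0 2 k

  open EvenModulus h {{h≢0}} public

  -- An odd p satisfies p ^ 2^k ≡ 1 modulo 2^(k+1) (odd^2^k), so p ^ (h − 1) inverts it.
  infix 9 _⁻¹
  _⁻¹ : Zn → Zn
  p ⁻¹ = reduce (toℕ p ^ (h ∸ 1))

  ⁻¹-inverseʳ : ∀ p → odd p ≡ 1 → p ⊗ p ⁻¹ ≡ 𝟙
  ⁻¹-inverseʳ p p-odd = let t , p^h≡ = odd^2^k k (toℕ p) p-odd in begin
    p ⊗ p ⁻¹                   ≡⟨ reduce-*ʳ p (toℕ p ^ (h ∸ 1)) ⟩
    reduce (toℕ p ^ suc (h ∸ 1)) ≡⟨ cong (λ e → reduce (toℕ p ^ e)) (ℕ.suc-pred h) ⟩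
    reduce (toℕ p ^ h)         ≡⟨ cong reduce p^h≡ ⟩
    reduce (1 + N * t)         ≡⟨ reduce-cong-% (%-remove-+ʳ 1 {N * t} {N} (m∣m*n t)) ⟩
    𝟙                          ∎
    where open ≡-Reasoning

  ⁻¹-inverseˡ : ∀ p → odd p ≡ 1 → p ⁻¹ ⊗ p ≡ 𝟙
  ⁻¹-inverseˡ p p-odd = trans (⊗-comm (p ⁻¹) p) (⁻¹-inverseʳ p p-odd)

  ∑-affine : ∀ p q → odd p ≡ 1 → (f : Zn → ℕ) → ∑[ x < N ] f (p ⊗ x ⊕ q) ≡ sum f
  ∑-affine p q p-odd = ∑-affine-unit p (p ⁻¹) (⁻¹-inverseˡ p p-odd) q

  mulFibre-odd : ∀ t d → odd t ≡ 1 → mulFibre t d ≡ 1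
  mulFibre-odd t d t-odd = mulFibre-unit t (t ⁻¹) (⁻¹-inverseˡ t t-odd) d

  evenFibre : Zn → ℕ
  evenFibre d = ∑[ t < N ] (even t * mulFibre t d)

  evenSolutions : Zn → Zn → ℕ
  evenSolutions b d = ∑[ t < N ] (even t * indicator (t ⊗ b ≟ᶠ d))

  evenFibre≡∑evenSolutions : ∀ d → evenFibre d ≡ ∑[ b < N ] evenSolutions b d
  evenFibre≡∑evenSolutions d =
    trans (sum-cong-≗ (λ t → sym (*-distribˡ-∑ (even t) (λ b → indicator (t ⊗ b ≟ᶠ d)))))
          (∑-comm (λ t b → even t * indicator (t ⊗ b ≟ᶠ d)))

  evenSolutions-odd : ∀ b d → odd b ≡ 1 → evenSolutions b d ≡ even d
  evenSolutions-odd b d b-odd = begin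
    ∑[ t < N ] (even t * indicator (t ⊗ b ≟ᶠ d))   ≡⟨ sum-cong-≗ term ⟩
    ∑[ t < N ] (even d * indicator (b ⊗ t ≟ᶠ d))   ≡⟨ *-distribˡ-∑ (even d) (λ t → indicator (b ⊗ t ≟ᶠ d)) ⟩
    even d * mulFibre b d                         ≡⟨ cong (even d *_) (mulFibre-odd b d b-odd) ⟩
    even d * 1                                    ≡⟨ ℕ.*-identityʳ (even d) ⟩
    even d                                        ∎
    where
    open ≡-Reasoning
    term : ∀ t → even t * indicator (t ⊗ b ≟ᶠ d) ≡ even d * indicator (b ⊗ t ≟ᶠ d)
    term t with t ⊗ b ≟ᶠ d | b ⊗ t ≟ᶠ d
    ... | yes tb≡d | yes _   = cong (λ x → (1 ∸ x) * 1) (trans (sym (odd-⊗-odd b t b-odd)) (cong odd (trans (⊗-comm b t) tb≡d)))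
    ... | yes tb≡d | no bt≢d = contradiction (trans (⊗-comm b t) tb≡d) bt≢d
    ... | no tb≢d  | yes bt≡d = contradiction (trans (⊗-comm t b) bt≡d) tb≢d
    ... | no _     | no _    = trans (ℕ.*-zeroʳ (even t)) (sym (ℕ.*-zeroʳ (even d)))

  evenSolutions-≤ : ∀ b d → evenSolutions b d ≤ h
  evenSolutions-≤ b d = ℕ.≤-trans (∑-mono-≤ term) (ℕ.≤-reflexive ∑-even)
    where
    term : ∀ t → even t * indicator (t ⊗ b ≟ᶠ d) ≤ even t
    term t = ℕ.≤-trans (ℕ.*-monoʳ-≤ (even t) (indicator≤1 (t ⊗ b ≟ᶠ d))) (ℕ.≤-reflexive (ℕ.*-identityʳ (even t)))

  evenSolutions-𝟘 : ∀ d → evenSolutions 𝟘 d ≡ h * indicator (𝟘 ≟ᶠ d)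
  evenSolutions-𝟘 d = begin
    ∑[ t < N ] (even t * indicator (t ⊗ 𝟘 ≟ᶠ d))   ≡⟨ sum-cong-≗ (λ t → cong (even t *_) (indicator-cong (t ⊗ 𝟘 ≟ᶠ d) (𝟘 ≟ᶠ d)
                                                         (mk⇔ (trans (sym (⊗-zeroʳ t))) (trans (⊗-zeroʳ t))))) ⟩
    ∑[ t < N ] (even t * indicator (𝟘 ≟ᶠ d))       ≡⟨ *-distribʳ-∑ (indicator (𝟘 ≟ᶠ d)) even ⟩
    ∑[ t < N ] even t * indicator (𝟘 ≟ᶠ d)         ≡⟨ cong (_* indicator (𝟘 ≟ᶠ d)) ∑-even ⟩
    h * indicator (𝟘 ≟ᶠ d)                        ∎
    where open ≡-Reasoning

  evenFibre-≤ : ∀ d → evenFibre d ≤ h + h * h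
  evenFibre-≤ d = begin
    evenFibre d                           ≡⟨ evenFibre≡∑evenSolutions d ⟩
    ∑[ b < N ] evenSolutions b d          ≤⟨ ∑-mono-≤ term ⟩
    ∑[ b < N ] (odd b + even b * h)       ≡⟨ ∑-distrib-+ odd (λ b → even b * h) ⟩
    ∑[ b < N ] odd b + ∑[ b < N ] (even b * h) ≡⟨ cong₂ _+_ ∑-odd (trans (*-distribʳ-∑ h even) (cong (_* h) ∑-even)) ⟩
    h + h * h                             ∎
    where
    open ℕ.≤-Reasoning
    term : ∀ b → evenSolutions b d ≤ odd b + even b * h
    term b with odd-cases b
    ... | inj₂ b-odd rewrite b-odd = ℕ.≤-trans (ℕ.≤-reflexive (evenSolutions-odd b d b-odd)) (ℕ.m∸n≤m 1 (odd d))
    ... | inj₁ b-even rewrite b-even = ℕ.≤-trans (evenSolutions-≤ b d) (ℕ.≤-reflexive (sym (ℕ.+-identityʳ h)))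

  evenFibre-≥ : ∀ d → h * even d + h * indicator (𝟘 ≟ᶠ d) ≤ evenFibre d
  evenFibre-≥ d = begin
    h * even d + h * indicator (𝟘 ≟ᶠ d)
      ≡⟨ cong₂ _+_ (sym (trans (*-distribʳ-∑ (even d) odd) (cong (_* even d) ∑-odd)))
                   (sym (trans (∑-δ 𝟘 (λ _ → evenSolutions 𝟘 d)) (evenSolutions-𝟘 d))) ⟩
    ∑[ b < N ] (odd b * even d) + ∑[ b < N ] (indicator (b ≟ᶠ 𝟘) * evenSolutions 𝟘 d)
      ≡⟨ sym (∑-distrib-+ (λ b → odd b * even d) (λ b → indicator (b ≟ᶠ 𝟘) * evenSolutions 𝟘 d)) ⟩
    ∑[ b < N ] (odd b * even d + indicator (b ≟ᶠ 𝟘) * evenSolutions 𝟘 d)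
      ≤⟨ ∑-mono-≤ term ⟩
    ∑[ b < N ] evenSolutions b d
      ≡⟨ sym (evenFibre≡∑evenSolutions d) ⟩
    evenFibre d ∎
    where
    open ℕ.≤-Reasoning
    term : ∀ b → odd b * even d + indicator (b ≟ᶠ 𝟘) * evenSolutions 𝟘 d ≤ evenSolutions b d
    term b with odd-cases b | b ≟ᶠ 𝟘
    ... | inj₂ b-odd  | yes refl = contradiction (trans (sym b-odd) odd-𝟘) λ ()
    ... | inj₂ b-odd  | no _     = ℕ.≤-reflexive (begin-equality
      odd b * even d + 0 ≡⟨ ℕ.+-identityʳ _ ⟩
      odd b * even d     ≡⟨ cong (_* even d) b-odd ⟩
      even d + 0         ≡⟨ ℕ.+-identityʳ _ ⟩
      even d             ≡⟨ sym (evenSolutions-odd b d b-odd) ⟩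
      evenSolutions b d  ∎)
    ... | inj₁ b-even | yes refl = ℕ.≤-reflexive (cong₂ _+_ (cong (_* even d) b-even) (ℕ.*-identityˡ _))
    ... | inj₁ b-even | no _     = ℕ.≤-trans (ℕ.≤-reflexive (cong (λ x → x * even d + 0) b-even)) z≤n

  mulFibre-split : ∀ t d → mulFibre t d ≡ odd t + even t * mulFibre t d
  mulFibre-split t d with odd-cases t
  ... | inj₁ t-even rewrite t-even = sym (ℕ.+-identityʳ (mulFibre t d))
  ... | inj₂ t-odd  rewrite t-odd  = mulFibre-odd t d t-odd

  ∑-even-mulFibre : ∀ {n} (w : Vec Zn n) d →
                    ∑[ b < N ] (even (m₁₁ (b ∷ w)) * mulFibre (m₁₁ (b ∷ w)) d) ≡ odd (m₁₁ w) * evenFibre d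
  ∑-even-mulFibre w d with odd-cases (m₁₁ w)
  ... | inj₁ p-even rewrite p-even = begin
    ∑[ b < N ] (even (m₁₁ (b ∷ w)) * mulFibre (m₁₁ (b ∷ w)) d)
      ≡⟨ sum-cong-≗ (λ b → cong (λ x → (1 ∸ x) * mulFibre (m₁₁ (b ∷ w)) d)
                       (trans (cong odd (m₁₁-∷ b w)) (odd-affine-even (m₁₁ w) b (m₁₂ w) p-even (m₁₁-even⇒m₁₂-odd w p-even)))) ⟩
    ∑[ b < N ] 0
      ≡⟨ sum-replicate-zero N ⟩
    0 ∎
    where open ≡-Reasoning
  ... | inj₂ p-odd rewrite p-odd = begin
    ∑[ b < N ] g (m₁₁ (b ∷ w))              ≡⟨ sum-cong-≗ (λ b → cong g (m₁₁-∷ b w)) ⟩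
    ∑[ b < N ] g (m₁₁ w ⊗ b ⊕ m₁₂ w)        ≡⟨ ∑-affine (m₁₁ w) (m₁₂ w) p-odd g ⟩
    evenFibre d                            ≡⟨ sym (ℕ.+-identityʳ (evenFibre d)) ⟩
    evenFibre d + 0                        ∎
    where
    open ≡-Reasoning
    g : Zn → ℕ
    g t = even t * mulFibre t d

  -- In fibre₁₁-∷∷ an odd m₁₁ (b′ ∷ w) admits exactly one letter b, and even ones occur only for odd
  -- m₁₁ w, where b′ ↦ m₁₁ (b′ ∷ w) is an affine bijection.
  fibre₁₁-rec : ∀ n c → fibre₁₁ (2 + n) c ≡ oddCount (1 + n) + ∑ᵛ n (λ w → odd (m₁₁ w) * evenFibre (c ⊕ m₁₁ w))
  fibre₁₁-rec n c = begin
    fibre₁₁ (2 + n) c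
      ≡⟨ fibre₁₁-∷∷ n c ⟩
    ∑ᵛ n (λ w → ∑[ b < N ] mulFibre (p b w) (d w))
      ≡⟨ ∑ᵛ-cong n (λ w → sum-cong-≗ (λ b → mulFibre-split (p b w) (d w))) ⟩
    ∑ᵛ n (λ w → ∑[ b < N ] (odd (p b w) + even (p b w) * mulFibre (p b w) (d w)))
      ≡⟨ ∑ᵛ-cong n (λ w → ∑-distrib-+ (λ b → odd (p b w)) (λ b → even (p b w) * mulFibre (p b w) (d w))) ⟩
    ∑ᵛ n (λ w → ∑[ b < N ] odd (p b w) + ∑[ b < N ] (even (p b w) * mulFibre (p b w) (d w)))
      ≡⟨ ∑ᵛ-distrib-+ n _ _ ⟩
    oddCount (1 + n) + ∑ᵛ n (λ w → ∑[ b < N ] (even (p b w) * mulFibre (p b w) (d w)))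
      ≡⟨ cong (oddCount (1 + n) +_) (∑ᵛ-cong n (λ w → ∑-even-mulFibre w (d w))) ⟩
    oddCount (1 + n) + ∑ᵛ n (λ w → odd (m₁₁ w) * evenFibre (d w)) ∎
    where
    open ≡-Reasoning
    p : ∀ {n} → Zn → Vec Zn n → Zn
    p b w = m₁₁ (b ∷ w)
    d : ∀ {n} → Vec Zn n → Zn
    d w = c ⊕ m₁₁ w

  fibre₁₁-upper : ∀ n c → fibre₁₁ (2 + n) c ≤ oddCount (1 + n) + (h + h * h) * oddCount n
  fibre₁₁-upper n c = begin
    fibre₁₁ (2 + n) c
      ≡⟨ fibre₁₁-rec n c ⟩
    oddCount (1 + n) + ∑ᵛ n (λ w → odd (m₁₁ w) * evenFibre (c ⊕ m₁₁ w))
      ≤⟨ ℕ.+-monoʳ-≤ (oddCount (1 + n)) (∑ᵛ-mono-≤ n (λ w → ℕ.*-monoʳ-≤ (odd (m₁₁ w)) (evenFibre-≤ (c ⊕ m₁₁ w)))) ⟩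
    oddCount (1 + n) + ∑ᵛ n (λ w → odd (m₁₁ w) * (h + h * h))
      ≡⟨ cong (oddCount (1 + n) +_) (trans (∑ᵛ-cong n (λ w → ℕ.*-comm (odd (m₁₁ w)) (h + h * h))) (*-distribˡ-∑ᵛ n (h + h * h) _)) ⟩
    oddCount (1 + n) + (h + h * h) * oddCount n ∎
    where open ℕ.≤-Reasoning

  fibre₁₁-lower : ∀ n c → odd c ≡ 1 → oddCount (1 + n) + h * oddCount n + h * fibre₁₁ n (⊖ c) ≤ fibre₁₁ (2 + n) c
  fibre₁₁-lower n c c-odd = begin
    oddCount (1 + n) + h * oddCount n + h * fibre₁₁ n (⊖ c)
      ≡⟨ ℕ.+-assoc (oddCount (1 + n)) _ _ ⟩
    oddCount (1 + n) + (h * oddCount n + h * fibre₁₁ n (⊖ c))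
      ≡⟨ cong (oddCount (1 + n) +_) (sym (trans (∑ᵛ-distrib-+ n _ _) (cong₂ _+_ (*-distribˡ-∑ᵛ n h _) (*-distribˡ-∑ᵛ n h _)))) ⟩
    oddCount (1 + n) + ∑ᵛ n (λ w → h * odd (m₁₁ w) + h * indicator (m₁₁ w ≟ᶠ ⊖ c))
      ≤⟨ ℕ.+-monoʳ-≤ (oddCount (1 + n)) (∑ᵛ-mono-≤ n term) ⟩
    oddCount (1 + n) + ∑ᵛ n (λ w → odd (m₁₁ w) * evenFibre (c ⊕ m₁₁ w))
      ≡⟨ sym (fibre₁₁-rec n c) ⟩
    fibre₁₁ (2 + n) c ∎
    where
    open ℕ.≤-Reasoning
    p≡-c⇔ : ∀ p → (p ≡ ⊖ c) ⇔ (𝟘 ≡ c ⊕ p)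
    p≡-c⇔ p = mk⇔ (λ p≡-c → sym (trans (cong (c ⊕_) p≡-c) (⊖-inverseʳ c))) (λ 𝟘≡c+p → ⊖-unique c p (sym 𝟘≡c+p))
    term : ∀ {n} (w : Vec Zn n) → h * odd (m₁₁ w) + h * indicator (m₁₁ w ≟ᶠ ⊖ c) ≤ odd (m₁₁ w) * evenFibre (c ⊕ m₁₁ w)
    term w with odd-cases (m₁₁ w)
    ... | inj₁ p-even = ℕ.≤-trans (ℕ.≤-reflexive lhs≡0) z≤n
      where
      p≢-c : m₁₁ w ≢ ⊖ c
      p≢-c p≡-c = contradiction (trans (sym p-even) (trans (cong odd p≡-c) (trans (odd-⊖ c) c-odd))) λ ()
      lhs≡0 : h * odd (m₁₁ w) + h * indicator (m₁₁ w ≟ᶠ ⊖ c) ≡ 0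
      lhs≡0 = trans (cong₂ (λ x y → h * x + h * y) p-even (indicator-no (m₁₁ w ≟ᶠ ⊖ c) p≢-c))
                    (cong₂ _+_ (ℕ.*-zeroʳ h) (ℕ.*-zeroʳ h))
    ... | inj₂ p-odd = begin
      h * odd p + h * indicator (p ≟ᶠ ⊖ c)
        ≡⟨ cong₂ (λ x y → h * x + h * y) (trans p-odd (sym even[c⊕p])) (indicator-cong (p ≟ᶠ ⊖ c) (𝟘 ≟ᶠ c ⊕ p) (p≡-c⇔ p)) ⟩
      h * even (c ⊕ p) + h * indicator (𝟘 ≟ᶠ c ⊕ p)
        ≤⟨ evenFibre-≥ (c ⊕ p) ⟩
      evenFibre (c ⊕ p)
        ≡⟨ sym (ℕ.+-identityʳ _) ⟩
      1 * evenFibre (c ⊕ p)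
        ≡⟨ cong (_* evenFibre (c ⊕ p)) (sym p-odd) ⟩
      odd p * evenFibre (c ⊕ p) ∎
      where
      p = m₁₁ w
      even[c⊕p] : even (c ⊕ p) ≡ 1
      even[c⊕p] = cong (1 ∸_) (trans (odd-⊕ c p) (cong₂ (λ x y → (x + y) % 2) c-odd p-odd))

  oddCount≤fibre₁₁ : ∀ n e → oddCount n ≤ fibre₁₁ (1 + n) e
  oddCount≤fibre₁₁ n e = ∑ᵛ-mono-≤ n term
    where
    term : ∀ w → odd (m₁₁ w) ≤ ∑[ b < N ] indicator (m₁₁ (b ∷ w) ≟ᶠ e)
    term w with odd-cases (m₁₁ w)
    ... | inj₁ p-even rewrite p-even = z≤n
    ... | inj₂ p-odd  rewrite p-odd  = ℕ.≤-reflexive (sym (trans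
      (sum-cong-≗ (λ b → indicator-cong (m₁₁ (b ∷ w) ≟ᶠ e) (m₁₁ w ⊗ b ≟ᶠ e ⊕ ⊖ m₁₂ w)
                           (subst (λ x → (x ≡ e) ⇔ (m₁₁ w ⊗ b ≡ e ⊕ ⊖ m₁₂ w)) (sym (m₁₁-∷ b w)) (⊕-move (m₁₁ w ⊗ b) (m₁₂ w) e))))
      (mulFibre-odd (m₁₁ w) (e ⊕ ⊖ m₁₂ w) p-odd)))

  OddConstant : ℕ → Set
  OddConstant n = ∀ e → odd e ≡ 1 → fibre₁₁ n e ≡ fibre₁₁ n 𝟙

  ∑-by-m₁₁-odd : ∀ n → OddConstant n → (g : Zn → ℕ) →
                 ∑ᵛ n (λ w → odd (m₁₁ w) * g (m₁₁ w)) ≡ fibre₁₁ n 𝟙 * ∑[ e < N ] (odd e * g e)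
  ∑-by-m₁₁-odd n const g = begin
    ∑ᵛ n (λ w → odd (m₁₁ w) * g (m₁₁ w))        ≡⟨ ∑ᵛ-by-m₁₁ n (λ e → odd e * g e) ⟩
    ∑[ e < N ] (fibre₁₁ n e * (odd e * g e))    ≡⟨ sum-cong-≗ term ⟩
    ∑[ e < N ] (fibre₁₁ n 𝟙 * (odd e * g e))    ≡⟨ *-distribˡ-∑ (fibre₁₁ n 𝟙) (λ e → odd e * g e) ⟩
    fibre₁₁ n 𝟙 * ∑[ e < N ] (odd e * g e)      ∎
    where
    open ≡-Reasoning
    term : ∀ e → fibre₁₁ n e * (odd e * g e) ≡ fibre₁₁ n 𝟙 * (odd e * g e)
    term e with odd-cases e
    ... | inj₁ e-even rewrite e-even = trans (ℕ.*-zeroʳ (fibre₁₁ n e)) (sym (ℕ.*-zeroʳ (fibre₁₁ n 𝟙)))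
    ... | inj₂ e-odd = cong (_* (odd e * g e)) (const e e-odd)

  oddCount-const : ∀ n → OddConstant n → oddCount n ≡ fibre₁₁ n 𝟙 * h
  oddCount-const n const = begin
    oddCount n                               ≡⟨ ∑ᵛ-cong n (λ w → sym (ℕ.*-identityʳ (odd (m₁₁ w)))) ⟩
    ∑ᵛ n (λ w → odd (m₁₁ w) * 1)             ≡⟨ ∑-by-m₁₁-odd n const (λ _ → 1) ⟩
    fibre₁₁ n 𝟙 * ∑[ e < N ] (odd e * 1)     ≡⟨ cong (fibre₁₁ n 𝟙 *_) (trans (sum-cong-≗ (λ e → ℕ.*-identityʳ (odd e))) ∑-odd) ⟩
    fibre₁₁ n 𝟙 * h                          ∎
    where open ≡-Reasoning

  oddShiftedFibre : Zn → ℕ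
  oddShiftedFibre c = ∑[ d < N ] (odd (d ⊕ ⊖ c) * evenFibre d)

  fibre₁₁-rec-const : ∀ n → OddConstant n → ∀ c → fibre₁₁ (2 + n) c ≡ oddCount (1 + n) + fibre₁₁ n 𝟙 * oddShiftedFibre c
  fibre₁₁-rec-const n const c = begin
    fibre₁₁ (2 + n) c                                                   ≡⟨ fibre₁₁-rec n c ⟩
    oddCount (1 + n) + ∑ᵛ n (λ w → odd (m₁₁ w) * evenFibre (c ⊕ m₁₁ w)) ≡⟨ cong (oddCount (1 + n) +_) (∑-by-m₁₁-odd n const (λ e → evenFibre (c ⊕ e))) ⟩
    oddCount (1 + n) + fibre₁₁ n 𝟙 * ∑[ e < N ] (odd e * evenFibre (c ⊕ e))
                                                                        ≡⟨ cong (λ x → oddCount (1 + n) + fibre₁₁ n 𝟙 * x) translate ⟩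
    oddCount (1 + n) + fibre₁₁ n 𝟙 * oddShiftedFibre c                  ∎
    where
    open ≡-Reasoning
    translate : ∑[ e < N ] (odd e * evenFibre (c ⊕ e)) ≡ oddShiftedFibre c
    translate = trans (sum-cong-≗ (λ e → cong (λ x → odd x * evenFibre (c ⊕ e)) (sym (⊕-⊖-cancel c e))))
                      (∑-translate c (λ d → odd (d ⊕ ⊖ c) * evenFibre d))

  oddShiftedFibre-parity : ∀ c c′ → odd c ≡ odd c′ → oddShiftedFibre c ≡ oddShiftedFibre c′
  oddShiftedFibre-parity c c′ c≡c′ = sum-cong-≗ λ d → cong (_* evenFibre d) (begin
    odd (d ⊕ ⊖ c)               ≡⟨ odd-⊕ d (⊖ c) ⟩
    (odd d + odd (⊖ c)) % 2     ≡⟨ cong (λ x → (odd d + x) % 2) (trans (odd-⊖ c) (trans c≡c′ (sym (odd-⊖ c′)))) ⟩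
    (odd d + odd (⊖ c′)) % 2    ≡⟨ sym (odd-⊕ d (⊖ c′)) ⟩
    odd (d ⊕ ⊖ c′)              ∎)
    where open ≡-Reasoning

  OddConstant-step : ∀ n → OddConstant n → OddConstant (2 + n)
  OddConstant-step n const e e-odd = begin
    fibre₁₁ (2 + n) e                                        ≡⟨ fibre₁₁-rec-const n const e ⟩
    oddCount (1 + n) + fibre₁₁ n 𝟙 * oddShiftedFibre e       ≡⟨ cong (λ x → oddCount (1 + n) + fibre₁₁ n 𝟙 * x)
                                                                   (oddShiftedFibre-parity e 𝟙 (trans e-odd (sym odd-𝟙))) ⟩
    oddCount (1 + n) + fibre₁₁ n 𝟙 * oddShiftedFibre 𝟙       ≡⟨ sym (fibre₁₁-rec-const n const 𝟙) ⟩
    fibre₁₁ (2 + n) 𝟙                                        ∎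
    where open ≡-Reasoning

  OddConstant-odd : ∀ j → OddConstant (1 + 2 * j)
  OddConstant-odd zero    e _ = trans (fibre₁₁-1 e) (sym (fibre₁₁-1 𝟙))
  OddConstant-odd (suc j) = subst OddConstant (cong suc (sym (ℕ.*-suc 2 j))) (OddConstant-step (1 + 2 * j) (OddConstant-odd j))

  sign : PM1 → Zn
  sign plus  = 𝟙
  sign minus = ⊖ 𝟙

  sign²≡𝟙 : ∀ ε → sign ε ⊗ sign ε ≡ 𝟙
  sign²≡𝟙 plus  = ⊗-identityˡ 𝟙
  sign²≡𝟙 minus = ⊖𝟙²≡𝟙

  odd-⊖sign : ∀ ε → odd (⊖ sign ε) ≡ 1
  odd-⊖sign plus  = trans (odd-⊖ 𝟙) odd-𝟙
  odd-⊖sign minus = trans (odd-⊖ (⊖ 𝟙)) (trans (odd-⊖ 𝟙) odd-𝟙)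

  εId≡scalar : ∀ ε → εId (suc k) ε ≡ scalar (sign ε)
  εId≡scalar plus  = refl
  εId≡scalar minus = scal-Id (⊖ 𝟙)

  Ω≡fibre₁₁ : ∀ n ε → Ω-card (suc k) (2 + n) ε ≡ fibre₁₁ n (⊖ sign ε)
  Ω≡fibre₁₁ n ε = trans (cong (count (2 + n)) (εId≡scalar ε)) (count-scalar (sign²≡𝟙 ε) n)

  Ω-odd-length : ∀ j ε → Ω-card (suc k) (3 + 2 * j) ε * h ≡ oddCount (1 + 2 * j)
  Ω-odd-length j ε = begin
    Ω-card (suc k) (3 + 2 * j) ε * h      ≡⟨ cong (_* h) (Ω≡fibre₁₁ (1 + 2 * j) ε) ⟩
    fibre₁₁ (1 + 2 * j) (⊖ sign ε) * h    ≡⟨ cong (_* h) (OddConstant-odd j (⊖ sign ε) (odd-⊖sign ε)) ⟩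
    fibre₁₁ (1 + 2 * j) 𝟙 * h             ≡⟨ sym (oddCount-const (1 + 2 * j) (OddConstant-odd j)) ⟩
    oddCount (1 + 2 * j)                  ∎
    where open ≡-Reasoning

  oddCount′ : ℕ → ℕ
  oddCount′ zero    = 0
  oddCount′ (suc i) = oddCount i

  Ω-upper : ∀ i ε → Ω-card (suc k) (6 + i) ε ≤ oddCount (3 + i) + h * oddCount (2 + i) + h * h * oddCount (2 + i)
  Ω-upper i ε = begin
    Ω-card (suc k) (6 + i) ε                                      ≡⟨ Ω≡fibre₁₁ (4 + i) ε ⟩
    fibre₁₁ (4 + i) (⊖ sign ε)                                    ≤⟨ fibre₁₁-upper (2 + i) (⊖ sign ε) ⟩
    oddCount (3 + i) + (h + h * h) * oddCount (2 + i)             ≡⟨ split (oddCount (3 + i)) h (oddCount (2 + i)) ⟩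
    oddCount (3 + i) + h * oddCount (2 + i) + h * h * oddCount (2 + i) ∎
    where
    open ℕ.≤-Reasoning
    split : ∀ a h u → a + (h + h * h) * u ≡ a + h * u + h * h * u
    split = ℕ-solve-∀

  Ω-lower : ∀ i ε → oddCount (3 + i) + h * oddCount (2 + i) + suc k * h * oddCount′ i ≤ Ω-card (suc k) (6 + i) ε
  Ω-lower i ε = begin
    oddCount (3 + i) + h * oddCount (2 + i) + suc k * h * oddCount′ i
      ≡⟨ cong (oddCount (3 + i) + h * oddCount (2 + i) +_) (regroup (suc k) h (oddCount′ i)) ⟩
    oddCount (3 + i) + h * oddCount (2 + i) + h * (suc k * oddCount′ i)
      ≤⟨ ℕ.+-monoʳ-≤ (oddCount (3 + i) + h * oddCount (2 + i)) (ℕ.*-monoʳ-≤ h (ℕ.≤-trans (grow i) (oddCount≤fibre₁₁ (1 + i) (sign ε)))) ⟩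
    oddCount (3 + i) + h * oddCount (2 + i) + h * fibre₁₁ (2 + i) (sign ε)
      ≡⟨ cong (λ e → oddCount (3 + i) + h * oddCount (2 + i) + h * fibre₁₁ (2 + i) e) (sym (⊖-involutive (sign ε))) ⟩
    oddCount (3 + i) + h * oddCount (2 + i) + h * fibre₁₁ (2 + i) (⊖ ⊖ sign ε)
      ≤⟨ fibre₁₁-lower (2 + i) (⊖ sign ε) (odd-⊖sign ε) ⟩
    fibre₁₁ (4 + i) (⊖ sign ε)
      ≡⟨ sym (Ω≡fibre₁₁ (4 + i) ε) ⟩
    Ω-card (suc k) (6 + i) ε ∎
    where
    open ℕ.≤-Reasoning
    regroup : ∀ m h u → m * h * u ≡ h * (m * u)
    regroup = ℕ-solve-∀
    grow : ∀ i → suc k * oddCount′ i ≤ oddCount (1 + i)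
    grow zero    = ℕ.≤-trans (ℕ.≤-reflexive (ℕ.*-zeroʳ (suc k))) z≤n
    grow (suc i) = oddCount-grow i (suc k) (ℕ.≤-trans (n<2^n k) (ℕ.m≤m*n h N))

  2^k·i≡hⁱ : ∀ i → ℤ.+ (2 ^ (k * i)) ≡ (ℤ.+ h) ℤ.^ i
  2^k·i≡hⁱ i = trans (cong ℤ.+_ (sym (ℕ.^-*-assoc 2 k i))) (pos-^ h i)

  2^[3+k]·3≡ : ℤ.+ (2 ^ (3 + k) * 3) ≡ ℤ.+ 2 ℤ.* (ℤ.+ 2 ℤ.* (ℤ.+ 2 ℤ.* ℤ.+ h)) ℤ.* ℤ.+ 3
  2^[3+k]·3≡ = trans (ℤ.pos-* (2 ^ (3 + k)) 3)
    (cong (ℤ._* ℤ.+ 3) (trans (pos-^ 2 (3 + k)) (cong (λ x → ℤ.+ 2 ℤ.* (ℤ.+ 2 ℤ.* (ℤ.+ 2 ℤ.* x))) (sym (pos-^ 2 k)))))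

  D-numerator : ∀ i → ℤ.+ (2 ^ (k * i)) ℤ.* (ℤ.+ (2 ^ (2 + i + 1)) ℤ.+ ℤ.+ 8 ℤ.* (-[1+ 0 ] ℤ.^ (2 + i + 1))) ℤ.* ℤ.+ 1
                      ≡ ℤ.+ (oddCount′ i) ℤ.* ℤ.+ (2 ^ (3 + k) * 3)
  D-numerator zero    = cong (ℤ._* ℤ.+ 1) (ℤ.*-zeroʳ (ℤ.+ (2 ^ (k * 0))))
  D-numerator (suc i) = begin
    ℤ.+ (2 ^ (k * suc i)) ℤ.* (ℤ.+ (2 ^ (2 + suc i + 1)) ℤ.+ ℤ.+ 8 ℤ.* (-[1+ 0 ] ℤ.^ (2 + suc i + 1))) ℤ.* ℤ.+ 1
      ≡⟨ cong₂ (λ x e → x ℤ.* (ℤ.+ (2 ^ e) ℤ.+ ℤ.+ 8 ℤ.* (-[1+ 0 ] ℤ.^ e)) ℤ.* ℤ.+ 1) (2^k·i≡hⁱ (suc i)) exponent ⟩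
    H ℤ.* Hⁱ ℤ.* (ℤ.+ (2 ^ (4 + i)) ℤ.+ ℤ.+ 8 ℤ.* (-[1+ 0 ] ℤ.^ (4 + i))) ℤ.* ℤ.+ 1
      ≡⟨ cong (λ x → H ℤ.* Hⁱ ℤ.* (x ℤ.+ ℤ.+ 8 ℤ.* (-[1+ 0 ] ℤ.^ (4 + i))) ℤ.* ℤ.+ 1) (pos-^ 2 (4 + i)) ⟩
    H ℤ.* Hⁱ ℤ.* (ℤ.+ 2 ℤ.* (ℤ.+ 2 ℤ.* (ℤ.+ 2 ℤ.* (ℤ.+ 2 ℤ.* P))) ℤ.+ ℤ.+ 8 ℤ.* (ℤ.-1ℤ ℤ.* (ℤ.-1ℤ ℤ.* (ℤ.-1ℤ ℤ.* (ℤ.-1ℤ ℤ.* S))))) ℤ.* ℤ.+ 1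
      ≡⟨ factor H Hⁱ P S ⟩
    ℤ.+ 8 ℤ.* H ℤ.* (Hⁱ ℤ.* (ℤ.+ 2 ℤ.* P ℤ.+ S))
      ≡⟨ cong (ℤ.+ 8 ℤ.* H ℤ.*_) (sym (oddCount-closed i)) ⟩
    ℤ.+ 8 ℤ.* H ℤ.* (ℤ.+ 3 ℤ.* U)
      ≡⟨ rearrange H U ⟩
    U ℤ.* (ℤ.+ 2 ℤ.* (ℤ.+ 2 ℤ.* (ℤ.+ 2 ℤ.* H)) ℤ.* ℤ.+ 3)
      ≡⟨ cong (U ℤ.*_) (sym 2^[3+k]·3≡) ⟩
    U ℤ.* ℤ.+ (2 ^ (3 + k) * 3) ∎
    where
    open ≡-Reasoning
    H  = ℤ.+ h
    Hⁱ = H ℤ.^ i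
    P  = (ℤ.+ 2) ℤ.^ i
    S  = ℤ.-1ℤ ℤ.^ i
    U  = ℤ.+ oddCount i
    exponent : 2 + suc i + 1 ≡ 4 + i
    exponent = cong (λ x → 3 + x) (ℕ.+-comm i 1)
    factor : ∀ H Hⁱ P S → H ℤ.* Hⁱ ℤ.* (ℤ.+ 2 ℤ.* (ℤ.+ 2 ℤ.* (ℤ.+ 2 ℤ.* (ℤ.+ 2 ℤ.* P))) ℤ.+ ℤ.+ 8 ℤ.* (ℤ.-1ℤ ℤ.* (ℤ.-1ℤ ℤ.* (ℤ.-1ℤ ℤ.* (ℤ.-1ℤ ℤ.* S))))) ℤ.* ℤ.+ 1
                           ≡ ℤ.+ 8 ℤ.* H ℤ.* (Hⁱ ℤ.* (ℤ.+ 2 ℤ.* P ℤ.+ S))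
    factor = solve-∀
    rearrange : ∀ H U → ℤ.+ 8 ℤ.* H ℤ.* (ℤ.+ 3 ℤ.* U) ≡ U ℤ.* (ℤ.+ 2 ℤ.* (ℤ.+ 2 ℤ.* (ℤ.+ 2 ℤ.* H)) ℤ.* ℤ.+ 3)
    rearrange = solve-∀

  D≡oddCount′ : ∀ i → D (suc k) (2 + i) ≡ ℕ→ℚ (oddCount′ i)
  D≡oddCount′ i = begin
    D (suc k) (2 + i)
      ≡⟨ cong (ℚ._* (Z / 3)) (pow2≡/ _ (k * i) (3 + k) exponent) ⟩
    ℤ.+ (2 ^ (k * i)) / 2 ^ (3 + k) ℚ.* (Z / 3)
      ≡⟨ /-*-/ (ℤ.+ (2 ^ (k * i))) Z (2 ^ (3 + k)) 3 ⟩
    (ℤ.+ (2 ^ (k * i)) ℤ.* Z) / (2 ^ (3 + k) * 3)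
      ≡⟨ /-cong-≃ (ℤ.+ (2 ^ (k * i)) ℤ.* Z) (2 ^ (3 + k) * 3) (ℤ.+ (oddCount′ i)) 1 (D-numerator i) ⟩
    ℕ→ℚ (oddCount′ i) ∎
    where
    open ≡-Reasoning
    instance
      2^[3+k]≢0 : NonZero (2 ^ (3 + k))
      2^[3+k]≢0 = ℕ.m^n≢0 2 (3 + k)
      2^[3+k]·3≢0 : NonZero (2 ^ (3 + k) * 3)
      2^[3+k]·3≢0 = ℕ.m*n≢0 (2 ^ (3 + k)) 3
    Z : ℤ
    Z = ℤ.+ (2 ^ (2 + i + 1)) ℤ.+ ℤ.+ 8 ℤ.* (-[1+ 0 ] ℤ.^ (2 + i + 1))
    exponent : ℤ.+ suc k ℤ.* ℤ.+ (2 + i) ℤ.- ℤ.+ (2 + i) ℤ.- ℤ.+ (3 * suc k) ≡ ℤ.+ (k * i) ℤ.- ℤ.+ (3 + k)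
    exponent = trans (collect (ℤ.+ k) (ℤ.+ i)) (cong (ℤ._- ℤ.+ (3 + k)) (sym (ℤ.pos-* k i)))
      where
      collect : ∀ K I → (ℤ.+ 1 ℤ.+ K) ℤ.* (ℤ.+ 2 ℤ.+ I) ℤ.- (ℤ.+ 2 ℤ.+ I) ℤ.- ℤ.+ 3 ℤ.* (ℤ.+ 1 ℤ.+ K) ≡ K ℤ.* I ℤ.- (ℤ.+ 3 ℤ.+ K)
      collect = solve-∀

  oddFormula-numerator : ∀ j ε → ℤ.+ (2 ^ (k * (2 * j))) ℤ.* (ℤ.+ (2 ^ (2 * suc j + 3)) ℤ.- ℤ.+ 8) ℤ.* ℤ.+ 1
                                 ≡ ℤ.+ (Ω-card (suc k) (3 + 2 * j) ε) ℤ.* ℤ.+ 24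
  oddFormula-numerator j ε = ℤ.*-cancelˡ-≡ H _ _ (begin
    H ℤ.* (ℤ.+ (2 ^ (k * (2 * j))) ℤ.* (ℤ.+ (2 ^ (2 * suc j + 3)) ℤ.- ℤ.+ 8) ℤ.* ℤ.+ 1)
      ≡⟨ cong₂ (λ x e → H ℤ.* (x ℤ.* (ℤ.+ (2 ^ e) ℤ.- ℤ.+ 8) ℤ.* ℤ.+ 1)) (2^k·i≡hⁱ (2 * j)) exponent ⟩
    H ℤ.* (Hʲ ℤ.* (ℤ.+ (2 ^ (5 + 2 * j)) ℤ.- ℤ.+ 8) ℤ.* ℤ.+ 1)
      ≡⟨ cong (λ x → H ℤ.* (Hʲ ℤ.* (x ℤ.- ℤ.+ 8) ℤ.* ℤ.+ 1)) (pos-^ 2 (5 + 2 * j)) ⟩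
    H ℤ.* (Hʲ ℤ.* (ℤ.+ 2 ℤ.* (ℤ.+ 2 ℤ.* (ℤ.+ 2 ℤ.* (ℤ.+ 2 ℤ.* (ℤ.+ 2 ℤ.* P)))) ℤ.- ℤ.+ 8) ℤ.* ℤ.+ 1)
      ≡⟨ factor H Hʲ P ⟩
    ℤ.+ 8 ℤ.* (H ℤ.* Hʲ ℤ.* (ℤ.+ 2 ℤ.* (ℤ.+ 2 ℤ.* P) ℤ.+ ℤ.-1ℤ ℤ.* ℤ.+ 1))
      ≡⟨ cong (λ s → ℤ.+ 8 ℤ.* (H ℤ.* Hʲ ℤ.* (ℤ.+ 2 ℤ.* (ℤ.+ 2 ℤ.* P) ℤ.+ ℤ.-1ℤ ℤ.* s))) (sym [-1]^2j≡1) ⟩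
    ℤ.+ 8 ℤ.* (H ℤ.* Hʲ ℤ.* (ℤ.+ 2 ℤ.* (ℤ.+ 2 ℤ.* P) ℤ.+ ℤ.-1ℤ ℤ.* (ℤ.-1ℤ ℤ.^ (2 * j))))
      ≡⟨ cong (ℤ.+ 8 ℤ.*_) (sym (oddCount-closed (1 + 2 * j))) ⟩
    ℤ.+ 8 ℤ.* (ℤ.+ 3 ℤ.* ℤ.+ oddCount (1 + 2 * j))
      ≡⟨ cong (λ u → ℤ.+ 8 ℤ.* (ℤ.+ 3 ℤ.* u)) (trans (cong ℤ.+_ (sym (Ω-odd-length j ε))) (ℤ.pos-* Ω h)) ⟩
    ℤ.+ 8 ℤ.* (ℤ.+ 3 ℤ.* (ℤ.+ Ω ℤ.* H))
      ≡⟨ rearrange H (ℤ.+ Ω) ⟩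
    H ℤ.* (ℤ.+ Ω ℤ.* ℤ.+ 24) ∎)
    where
    open ≡-Reasoning
    Ω  = Ω-card (suc k) (3 + 2 * j) ε
    H  = ℤ.+ h
    Hʲ = H ℤ.^ (2 * j)
    P  = (ℤ.+ 2) ℤ.^ (2 * j)
    exponent : 2 * suc j + 3 ≡ 5 + 2 * j
    exponent = trans (cong (_+ 3) (ℕ.*-suc 2 j)) (cong (2 +_) (ℕ.+-comm (2 * j) 3))
    [-1]^2j≡1 : ℤ.-1ℤ ℤ.^ (2 * j) ≡ ℤ.+ 1
    [-1]^2j≡1 = trans (sym (ℤ.^-*-assoc ℤ.-1ℤ 2 j)) (ℤ.^-zeroˡ j)
    factor : ∀ H Hʲ P → H ℤ.* (Hʲ ℤ.* (ℤ.+ 2 ℤ.* (ℤ.+ 2 ℤ.* (ℤ.+ 2 ℤ.* (ℤ.+ 2 ℤ.* (ℤ.+ 2 ℤ.* P)))) ℤ.- ℤ.+ 8) ℤ.* ℤ.+ 1)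
                        ≡ ℤ.+ 8 ℤ.* (H ℤ.* Hʲ ℤ.* (ℤ.+ 2 ℤ.* (ℤ.+ 2 ℤ.* P) ℤ.+ ℤ.-1ℤ ℤ.* ℤ.+ 1))
    factor = solve-∀
    rearrange : ∀ H Ω → ℤ.+ 8 ℤ.* (ℤ.+ 3 ℤ.* (Ω ℤ.* H)) ≡ H ℤ.* (Ω ℤ.* ℤ.+ 24)
    rearrange = solve-∀

  oddFormula≡Ω : ∀ j ε → oddFormula (suc k) (suc j) ≡ ℕ→ℚ (Ω-card (suc k) (3 + 2 * j) ε)
  oddFormula≡Ω j ε = begin
    oddFormula (suc k) (suc j)
      ≡⟨ cong (ℚ._* (Z / 3)) (pow2≡/ _ (k * (2 * j)) 3 exponent) ⟩
    ℤ.+ (2 ^ (k * (2 * j))) / 8 ℚ.* (Z / 3)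
      ≡⟨ /-*-/ (ℤ.+ (2 ^ (k * (2 * j)))) Z 8 3 ⟩
    (ℤ.+ (2 ^ (k * (2 * j))) ℤ.* Z) / 24
      ≡⟨ /-cong-≃ (ℤ.+ (2 ^ (k * (2 * j))) ℤ.* Z) 24 (ℤ.+ (Ω-card (suc k) (3 + 2 * j) ε)) 1 (oddFormula-numerator j ε) ⟩
    ℕ→ℚ (Ω-card (suc k) (3 + 2 * j) ε) ∎
    where
    open ≡-Reasoning
    Z : ℤ
    Z = ℤ.+ (2 ^ (2 * suc j + 3)) ℤ.- ℤ.+ 8
    exponent : ℤ.+ 2 ℤ.* ℤ.+ suc k ℤ.* ℤ.+ suc j ℤ.- ℤ.+ 2 ℤ.* ℤ.+ suc j ℤ.- ℤ.+ 2 ℤ.* ℤ.+ suc k ℤ.- ℤ.+ 1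
               ≡ ℤ.+ (k * (2 * j)) ℤ.- ℤ.+ 3
    exponent = trans (collect (ℤ.+ k) (ℤ.+ j))
      (cong (ℤ._- ℤ.+ 3) (sym (trans (ℤ.pos-* k (2 * j)) (cong (ℤ.+ k ℤ.*_) (ℤ.pos-* 2 j)))))
      where
      collect : ∀ K J → ℤ.+ 2 ℤ.* (ℤ.+ 1 ℤ.+ K) ℤ.* (ℤ.+ 1 ℤ.+ J) ℤ.- ℤ.+ 2 ℤ.* (ℤ.+ 1 ℤ.+ J) ℤ.- ℤ.+ 2 ℤ.* (ℤ.+ 1 ℤ.+ K) ℤ.- ℤ.+ 1
                      ≡ K ℤ.* (ℤ.+ 2 ℤ.* J) ℤ.- ℤ.+ 3
      collect = solve-∀

  EvenBounds : ℕ → PM1 → Set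
  EvenBounds L ε =
      (D (suc k) L +ℚ ℕ→ℚ h *ℚ D (suc k) (L ∸ 1) +ℚ ℕ→ℚ (suc k * h) *ℚ D (suc k) (L ∸ 4) ≤ℚ ℕ→ℚ (Ω-card (suc k) L ε))
    × (ℕ→ℚ (Ω-card (suc k) L ε) ≤ℚ D (suc k) L +ℚ ℕ→ℚ h *ℚ D (suc k) (L ∸ 1) +ℚ ℕ→ℚ (2 ^ (2 * suc k ∸ 2)) *ℚ D (suc k) (L ∸ 1))

  even-bounds : ∀ i ε → EvenBounds (6 + i) ε
  even-bounds i ε =
      subst (_≤ℚ ℕ→ℚ Ω) (sym lower-sum) (ℕ→ℚ-mono-≤ (Ω-lower i ε))
    , subst (ℕ→ℚ Ω ≤ℚ_) (sym upper-sum) (ℕ→ℚ-mono-≤ (Ω-upper i ε))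
    where
    open ≡-Reasoning
    Ω  = Ω-card (suc k) (6 + i) ε
    U₃ = oddCount (3 + i)
    U₂ = oddCount (2 + i)
    D₆ : D (suc k) (6 + i) ≡ ℕ→ℚ U₃
    D₆ = D≡oddCount′ (4 + i)
    D₅ : D (suc k) (5 + i) ≡ ℕ→ℚ U₂
    D₅ = D≡oddCount′ (3 + i)
    h²≡ : 2 ^ (2 * suc k ∸ 2) ≡ h * h
    h²≡ = trans (cong (λ e → 2 ^ (e ∸ 2)) (ℕ.*-suc 2 k))
                (trans (cong (λ e → 2 ^ (k + e)) (ℕ.+-identityʳ k)) (ℕ.^-distribˡ-+-* 2 k k))
    lower-sum : D (suc k) (6 + i) +ℚ ℕ→ℚ h *ℚ D (suc k) (5 + i) +ℚ ℕ→ℚ (suc k * h) *ℚ D (suc k) (2 + i)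
                ≡ ℕ→ℚ (U₃ + h * U₂ + suc k * h * oddCount′ i)
    lower-sum = begin
      D (suc k) (6 + i) +ℚ ℕ→ℚ h *ℚ D (suc k) (5 + i) +ℚ ℕ→ℚ (suc k * h) *ℚ D (suc k) (2 + i)
        ≡⟨ cong₂ (λ x y → x +ℚ ℕ→ℚ h *ℚ y +ℚ ℕ→ℚ (suc k * h) *ℚ D (suc k) (2 + i)) D₆ D₅ ⟩
      ℕ→ℚ U₃ +ℚ ℕ→ℚ h *ℚ ℕ→ℚ U₂ +ℚ ℕ→ℚ (suc k * h) *ℚ D (suc k) (2 + i)
        ≡⟨ cong (λ z → ℕ→ℚ U₃ +ℚ ℕ→ℚ h *ℚ ℕ→ℚ U₂ +ℚ ℕ→ℚ (suc k * h) *ℚ z) (D≡oddCount′ i) ⟩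
      ℕ→ℚ U₃ +ℚ ℕ→ℚ h *ℚ ℕ→ℚ U₂ +ℚ ℕ→ℚ (suc k * h) *ℚ ℕ→ℚ (oddCount′ i)
        ≡⟨ ℕ→ℚ-linear U₃ h U₂ (suc k * h) (oddCount′ i) ⟩
      ℕ→ℚ (U₃ + h * U₂ + suc k * h * oddCount′ i) ∎
    upper-sum : D (suc k) (6 + i) +ℚ ℕ→ℚ h *ℚ D (suc k) (5 + i) +ℚ ℕ→ℚ (2 ^ (2 * suc k ∸ 2)) *ℚ D (suc k) (5 + i)
                ≡ ℕ→ℚ (U₃ + h * U₂ + h * h * U₂)
    upper-sum = begin
      D (suc k) (6 + i) +ℚ ℕ→ℚ h *ℚ D (suc k) (5 + i) +ℚ ℕ→ℚ (2 ^ (2 * suc k ∸ 2)) *ℚ D (suc k) (5 + i)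
        ≡⟨ cong₂ (λ x y → x +ℚ ℕ→ℚ h *ℚ y +ℚ ℕ→ℚ (2 ^ (2 * suc k ∸ 2)) *ℚ y) D₆ D₅ ⟩
      ℕ→ℚ U₃ +ℚ ℕ→ℚ h *ℚ ℕ→ℚ U₂ +ℚ ℕ→ℚ (2 ^ (2 * suc k ∸ 2)) *ℚ ℕ→ℚ U₂
        ≡⟨ cong (λ z → ℕ→ℚ U₃ +ℚ ℕ→ℚ h *ℚ ℕ→ℚ U₂ +ℚ ℕ→ℚ z *ℚ ℕ→ℚ U₂) h²≡ ⟩
      ℕ→ℚ U₃ +ℚ ℕ→ℚ h *ℚ ℕ→ℚ U₂ +ℚ ℕ→ℚ (h * h) *ℚ ℕ→ℚ U₂
        ≡⟨ ℕ→ℚ-linear U₃ h U₂ (h * h) U₂ ⟩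
      ℕ→ℚ (U₃ + h * U₂ + h * h * U₂) ∎

  even-length : ∀ n → 3 ≤ n → ∀ ε → EvenBounds (2 * n) ε
  even-length (suc zero)          (s≤s ())             ε
  even-length (suc (suc zero))    (s≤s (s≤s ()))       ε
  even-length (suc (suc (suc j))) _ ε =
    subst (λ L → EvenBounds L ε) (sym (ℕ.*-distribˡ-+ 2 3 j)) (even-bounds (2 * j) ε)

  odd-length : ∀ n → 1 ≤ n → ∀ ε → ℕ→ℚ (Ω-card (suc k) (2 * n + 1) ε) ≡ oddFormula (suc k) n
  odd-length (suc j) _ ε =
    trans (cong (λ L → ℕ→ℚ (Ω-card (suc k) L ε)) (trans (cong (_+ 1) (ℕ.*-suc 2 j)) (cong (2 +_) (ℕ.+-comm (2 * j) 1))))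
          (sym (oddFormula≡Ω j ε))

-- Every bound holds for m ≥ 1; the hypothesis 2 ≤ m only rules out m = 0.
theorem1p4 : (m : ℕ) → 2 ≤ m → (ε : PM1) →
  ((n : ℕ) → 2 ≤ n →
    (ℕ→ℚ (w⁺ (2 * n + 1) m) ≡ oddFormula m n)
    × (ℕ→ℚ (w⁻ (2 * n + 1) m) ≡ oddFormula m n))
  × ((n : ℕ) → 3 ≤ n →
    ((D m (2 * n) +ℚ (ℕ→ℚ (2 ^ (m ∸ 1)) *ℚ D m (2 * n ∸ 1))
        +ℚ (ℕ→ℚ (m * 2 ^ (m ∸ 1)) *ℚ D m (2 * n ∸ 4))
      ≤ℚ ℕ→ℚ (Ω-card m (2 * n) ε))
    × (ℕ→ℚ (Ω-card m (2 * n) ε)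
      ≤ℚ (D m (2 * n) +ℚ (ℕ→ℚ (2 ^ (m ∸ 1)) *ℚ D m (2 * n ∸ 1)))
        +ℚ (ℕ→ℚ (2 ^ (2 * m ∸ 2)) *ℚ D m (2 * n ∸ 1)))))
theorem1p4 zero    ()
theorem1p4 (suc k) _ ε =
    (λ n 2≤n → odd-length n (ℕ.<⇒≤ 2≤n) plus , odd-length n (ℕ.<⇒≤ 2≤n) minus)
  , (λ n 3≤n → even-length n 3≤n ε)
  where open TwoPowerModulus k
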